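{- Let $q$ be a prime power, $n\ge 1$, and let $\sigma$ be a generator of $\mathrm{Gal}(\mathbb{F}_{q^n}/\mathbb{F}_q)$. Let $L=a_0x+a_1x^{\sigma}+\dots+a_dx^{\sigma^d}\in\mathbb{F}_{q^n}[x]$ be a $\sigma$-linearized polynomial of $\sigma$-degree $d\ge 1$ (so $a_d\neq 0$) with $a_0\neq 0$, and let $A_L$ be the $d\times d$ matrix defined in the context. Then for every $\alpha\in\mathbb{F}_{q^n}^*$, $$\mathrm{null}(L_\alpha)=\mathrm{null}(A_L-\lambda I),\qquad\text{where }\lambda=N(\alpha).$$ In particular, the nullity of $L$ is equal to the nullity of $A_L-I$.
   Context: $x^\sigma=x^{q^s}$ for some $s$ with $\gcd(s,n)=1$; $x^{\sigma^i}$ denotes $i$-fold application of $\sigma$, and for a matrix $M$ over $\mathbb{F}_{q^n}$, $M^{\sigma}$ denotes $\sigma$ applied entrywise. $N(x)=x^{1+\sigma+\dots+\sigma^{n-1}}$ is the norm from $\mathbb{F}_{q^n}$ to $\mathbb{F}_q$. For $y\in\mathbb{F}_{q^n}$ and $i\ge 0$, $y^{[i]}:=y^{1+\sigma+\dots+\sigma^{i-1}}$ (with $y^{[0]}=1$). A $\sigma$-linearized polynomial $L=\sum a_ix^{\sigma^i}$ defines an $\mathbb{F}_q$-linear map $\mathbb{F}_{q^n}\to\mathbb{F}_{q^n}$; $\mathrm{null}(L)$ denotes the $\mathbb{F}_q$-dimension of its kernel in $\mathbb{F}_{q^n}$. For $\alpha\in\mathbb{F}_{q^n}$, $L_\alpha:=\sum_i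 a_i\alpha^{[i]}x^{\sigma^i}$. The companion matrix of $L$ is the $d\times d$ matrix $C_L$ with $1$'s on the subdiagonal, last column $(-a_0/a_d,-a_1/a_d,\dots,-a_{d-1}/a_d)^T$, and zeros elsewhere; $A_L:=C_LC_L^{\sigma}C_L^{\sigma^2}\cdots C_L^{\sigma^{n-1}}$. The nullity of the matrix $A_L-\lambda I$ is its nullity as a matrix over $\mathbb{F}_{q^n}$. -}

module Defs where

open import Level using (0ℓ)
open import Algebra.Bundles using (CommutativeRing)
open import Data.Nat using (ℕ; zero; suc; _∸_)
open import Data.Fin using (Fin; toℕ; inject₁; fromℕ)
open import Data.Bool using (if_then_else_)
open import Data.Product using (Σ; ∃; _×_)
open import Relation.Nullary using (¬_; does)
open import Relation.Binary.PropositionalEquality using (_≡_)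
import Data.Nat as ℕ

record FiniteField : Set₁ where
  field
    cring     : CommutativeRing 0ℓ 0ℓ
  open CommutativeRing cring public
  field
    0≉1       : ¬ (0# ≈ 1#)
    inv       : Carrier → Carrier
    inv-r     : ∀ x → ¬ (x ≈ 0#) → x * inv x ≈ 1#
    size      : ℕ
    enum      : Fin size → Carrier
    enum-inj  : ∀ i j → enum i ≈ enum j → i ≡ j
    enum-surj : ∀ x → ∃ λ i → enum i ≈ x

module _ (K : FiniteField) where
  open FiniteField K

  iter : (Carrier → Carrier) → ℕ → Carrier → Carrier
  iter σ zero    x = x
  iter σ (suc i) x = σ (iter σ i x)

  record IsAutomorphism (σ : Carrier → Carrier) : Set where
    field
      σ-cong : ∀ {x y} → x ≈ y → σ x ≈ σ y
      σ-+    : ∀ x y → σ (x + y) ≈ σ x + σ y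
      σ-*    : ∀ x y → σ (x * y) ≈ σ x * σ y
      σ-1    : σ 1# ≈ 1#
      σ-inj  : ∀ x y → σ x ≈ σ y → x ≈ y

  HasCard : (Carrier → Set) → ℕ → Set
  HasCard P m = Σ (Fin m → Carrier) λ e →
                  (∀ i → P (e i))
                × (∀ i j → e i ≈ e j → i ≡ j)
                × (∀ x → P x → ∃ λ i → e i ≈ x)

  Fixed : (Carrier → Carrier) → Carrier → Set
  Fixed σ x = σ x ≈ x

  ∑ : ∀ {k} → (Fin k → Carrier) → Carrier
  ∑ {zero}  f = 0#
  ∑ {suc k} f = f Fin.zero + ∑ (λ i → f (Fin.suc i))
    where import Data.Fin as Fin

  -- y^[i] = y^(1 + σ + … + σ^(i-1)),  y^[0] = 1
  bracketPow : (Carrier → Carrier) → Carrier → ℕ → Carrier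
  bracketPow σ y zero    = 1#
  bracketPow σ y (suc i) = bracketPow σ y i * iter σ i y

  Norm : (Carrier → Carrier) → ℕ → Carrier → Carrier
  Norm σ n x = bracketPow σ x n

  evalLα : (σ : Carrier → Carrier) (d : ℕ) (a : Fin (suc d) → Carrier)
           (α : Carrier) → Carrier → Carrier
  evalLα σ d a α x = ∑ (λ (i : Fin (suc d)) → a i * bracketPow σ α (toℕ i) * iter σ (toℕ i) x)

  Matrix : ℕ → Set
  Matrix d = Fin d → Fin d → Carrier

  idMat : ∀ {d} → Matrix d
  idMat i j = if does (toℕ i ℕ.≟ toℕ j) then 1# else 0#

  _⊗_ : ∀ {d} → Matrix d → Matrix d → Matrix d
  (M ⊗ N) i j = ∑ (λ k → M i k * N k j)

  mapMat : ∀ {d} → (Carrier → Carrier) → Matrix d → Matrix d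
  mapMat f M i j = f (M i j)

  -- companion matrix C_L (d × d): 1's on the subdiagonal (entry (i+1,i)),
  -- last column (-a_0/a_d, …, -a_{d-1}/a_d)^T, zeros elsewhere
  companion : (d : ℕ) (a : Fin (suc d) → Carrier) → Matrix d
  companion d a i j =
    if does (toℕ j ℕ.≟ d ∸ 1)
      then - (a (inject₁ i) * inv (a (fromℕ d)))
      else (if does (toℕ i ℕ.≟ suc (toℕ j)) then 1# else 0#)

  twistedProd : ∀ {d} → (Carrier → Carrier) → Matrix d → ℕ → Matrix d
  twistedProd σ C zero    = idMat
  twistedProd σ C (suc m) = twistedProd σ C m ⊗ mapMat (iter σ m) C

  A-L : (σ : Carrier → Carrier) (n d : ℕ) (a : Fin (suc d) → Carrier) → Matrix d
  A-L σ n d a = twistedProd σ (companion d a) n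

  shiftMat : ∀ {d} → Matrix d → Carrier → Matrix d
  shiftMat M λ' i j = M i j - λ' * idMat i j

  HasDim : {V : Set} (_≋_ : V → V → Set) (_⊕_ : V → V → V) (𝟘 : V)
           (_·_ : Carrier → V → V) (Scal : Carrier → Set) (W : V → Set)
           (k : ℕ) → Set
  HasDim {V} _≋_ _⊕_ 𝟘 _·_ Scal W k =
    Σ (Fin k → V) λ b →
        (∀ i → W (b i))
      × (∀ (c : Fin k → Carrier) → (∀ i → Scal (c i))
           → lin c b ≋ 𝟘 → ∀ i → c i ≈ 0#)
      × (∀ v → W v → ∃ λ (c : Fin k → Carrier) →
           (∀ i → Scal (c i)) × (v ≋ lin c b))
    where
      lin : ∀ {m} → (Fin m → Carrier) → (Fin m → V) → V
      lin {zero}  c b = 𝟘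
      lin {suc m} c b = (c Fin.zero · b Fin.zero) ⊕ lin (λ i → c (Fin.suc i)) (λ i → b (Fin.suc i))
        where import Data.Fin as Fin

  -- null(L) = k : the kernel of the map f : K → K has F_q-dimension k,
  -- F_q being the fixed field of σ
  NullityFq : (σ : Carrier → Carrier) (f : Carrier → Carrier) (k : ℕ) → Set
  NullityFq σ f k = HasDim _≈_ _+_ 0# _*_ (Fixed σ) (λ x → f x ≈ 0#) k

  NullityMat : ∀ {d} → Matrix d → ℕ → Set
  NullityMat {d} M k =
    HasDim (λ u v → ∀ i → u i ≈ v i) (λ u v i → u i + v i) (λ _ → 0#)
           (λ c v i → c * v i) (λ _ → Data.Unit.⊤)
           (λ v → ∀ i → ∑ (λ j → M i j * v j) ≈ 0#) k
    where import Data.Unit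

-- Let C be the companion matrix of L and T the σ-semilinear map w ↦ α σ(w) C⁻¹ on row vectors of length d.
-- By induction Tʲ(w) · C C^σ ⋯ C^{σ^(j-1)} = α^[j] σʲ(w), so, as σⁿ = 1, the vectors with Tⁿ w = w form the left
-- kernel of A_L - N(α) I. The vectors fixed by T are exactly (α^[i] σⁱ(x))ᵢ with L_α(x) = 0, an F_q-space of
-- dimension null(L_α), and Galois descent (via Dedekind's independence of 1, σ, …, σⁿ⁻¹) makes any F_q-basis of
-- them a K-basis of {w : Tⁿ w = w}. Left and right kernels of a square matrix have the same number of elements, and
-- a space with a basis of k vectors over a field with s elements has s ^ k elements, which pins down every dimension.
-- That σ has order exactly n follows from the same descent applied to the σ-twisted cyclic shift on K^m.

module Submission where

open import Defs
open import Data.Nat as ℕ using (ℕ; zero; suc; _<_; _≤_; _^_; _∸_; z≤n; s≤s)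
import Data.Nat.Properties as ℕₚ
open import Data.Fin as Fin using (Fin; zero; toℕ; fromℕ; inject₁)
import Data.Fin.Properties as Finₚ
open import Data.Product using (Σ; ∃; _×_; _,_; proj₁; proj₂)
open import Data.Unit using (⊤; tt)
open import Data.Empty using (⊥-elim)
open import Relation.Binary.Definitions using (tri<; tri≈; tri>)
open import Relation.Nullary using (¬_; Dec; yes; no; does; ¬?)
open import Relation.Nullary.Decidable using (decidable-stable; dec-true; dec-false)
open import Data.Bool using (if_then_else_)
open import Data.Nat.Divisibility using (divides; m∣m*n; m≤n⇒m!∣n!; ∣-trans)
open import Data.Nat.Base using (_!)
open import Relation.Binary.PropositionalEquality as ≡ using (_≡_; _≢_)
import Relation.Binary.Reasoning.Setoid as SetoidReasoning
open import Function using (_∘_)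
open import Data.Vec.Functional using ([]; _∷_; tail)
open import Data.Fin.Relation.Unary.Top using (view; ‵fromℕ; ‵inject₁)
open import Algebra.Properties.CommutativeMonoid.Sum ℕₚ.+-0-commutativeMonoid
  using (sum-syntax; sum-cong-≗) renaming (∑-comm to ∑ℕ-comm; ∑-distrib-+ to ∑ℕ-distrib-+)

module FieldProperties (K : FiniteField) where
  open FiniteField K public hiding (zero)
  open import Algebra.Properties.Ring ring public
  open import Algebra.Properties.CommutativeSemigroup *-commutativeSemigroup public
    using () renaming (x∙yz≈y∙xz to x*yz≈y*xz; xy∙z≈y∙xz to xy*z≈y*xz; x∙yz≈yx∙z to x*yz≈yx*z; interchange to *-interchange)
  open import Algebra.Properties.CommutativeSemigroup +-commutativeSemigroup public
    using () renaming (interchange to +-interchange)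
  open SetoidReasoning setoid

  private
    index : Carrier → Fin size
    index x = proj₁ (enum-surj x)

    enum-index : ∀ x → enum (index x) ≈ x
    enum-index x = proj₂ (enum-surj x)

  _≟_ : ∀ x y → Dec (x ≈ y)
  x ≟ y with index x Fin.≟ index y
  ... | yes e = yes (trans (sym (enum-index x)) (trans (reflexive (≡.cong enum e)) (enum-index y)))
  ... | no ne = no λ x≈y → ne (enum-inj _ _ (trans (enum-index x) (trans x≈y (sym (enum-index y)))))

  1≉0 : 1# ≉ 0#
  1≉0 e = 0≉1 (sym e)

  inv-l : ∀ x → x ≉ 0# → inv x * x ≈ 1#
  inv-l x x≉0 = trans (*-comm _ _) (inv-r x x≉0)

  x*y≈0⇒y≈0 : ∀ {x y} → x ≉ 0# → x * y ≈ 0# → y ≈ 0#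
  x*y≈0⇒y≈0 {x} {y} x≉0 xy≈0 = begin
    y               ≈⟨ *-identityˡ y ⟨
    1# * y          ≈⟨ *-congʳ (inv-l x x≉0) ⟨
    (inv x * x) * y ≈⟨ *-assoc _ _ _ ⟩
    inv x * (x * y) ≈⟨ *-congˡ xy≈0 ⟩
    inv x * 0#      ≈⟨ zeroʳ _ ⟩
    0#              ∎

  *-≉0 : ∀ {x y} → x ≉ 0# → y ≉ 0# → x * y ≉ 0#
  *-≉0 x≉0 y≉0 xy≈0 = y≉0 (x*y≈0⇒y≈0 x≉0 xy≈0)

  inv-≉0 : ∀ {x} → x ≉ 0# → inv x ≉ 0#
  inv-≉0 {x} x≉0 inv≈0 = 0≉1 (trans (sym (zeroʳ x)) (trans (*-congˡ (sym inv≈0)) (inv-r x x≉0)))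

  inv-cong : ∀ {x y} → x ≉ 0# → x ≈ y → inv x ≈ inv y
  inv-cong {x} {y} x≉0 x≈y = begin
    inv x                 ≈⟨ *-identityʳ _ ⟨
    inv x * 1#            ≈⟨ *-congˡ (inv-r y (λ y≈0 → x≉0 (trans x≈y y≈0))) ⟨
    inv x * (y * inv y)   ≈⟨ *-assoc _ _ _ ⟨
    (inv x * y) * inv y   ≈⟨ *-congʳ (*-congˡ x≈y) ⟨
    (inv x * x) * inv y   ≈⟨ *-congʳ (inv-l x x≉0) ⟩
    1# * inv y            ≈⟨ *-identityˡ _ ⟩
    inv y                 ∎

  c*x+y≈0⇒x≈-[c⁻¹*y] : ∀ {c x y} → c ≉ 0# → c * x + y ≈ 0# → x ≈ - (inv c * y)
  c*x+y≈0⇒x≈-[c⁻¹*y] {c} {x} {y} c≉0 e = begin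
    x                 ≈⟨ *-identityˡ x ⟨
    1# * x            ≈⟨ *-congʳ (inv-l c c≉0) ⟨
    (inv c * c) * x   ≈⟨ *-assoc _ _ _ ⟩
    inv c * (c * x)   ≈⟨ *-congˡ (+-inverseˡ-unique (c * x) y e) ⟩
    inv c * (- y)     ≈⟨ -‿distribʳ-* _ _ ⟨
    - (inv c * y)     ∎

iterate : {A : Set} → (A → A) → ℕ → A → A
iterate f zero    x = x
iterate f (suc j) x = f (iterate f j x)

iterate-suc : {A : Set} (f : A → A) (j : ℕ) (x : A) → iterate f (suc j) x ≡ iterate f j (f x)
iterate-suc f zero    x = ≡.refl
iterate-suc f (suc j) x = ≡.cong f (iterate-suc f j x)

iterate-+ : {A : Set} (f : A → A) (i j : ℕ) (x : A) → iterate f (i ℕ.+ j) x ≡ iterate f i (iterate f j x)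
iterate-+ f zero    j x = ≡.refl
iterate-+ f (suc i) j x = ≡.cong f (iterate-+ f i j x)

module Automorphisms (K : FiniteField) where
  open FieldProperties K
  open SetoidReasoning setoid

  iter-suc : ∀ σ j x → iter K σ (suc j) x ≡ iter K σ j (σ x)
  iter-suc σ zero    x = ≡.refl
  iter-suc σ (suc j) x = ≡.cong σ (iter-suc σ j x)

  iter-+ : ∀ σ i j x → iter K σ (i ℕ.+ j) x ≡ iter K σ i (iter K σ j x)
  iter-+ σ zero    j x = ≡.refl
  iter-+ σ (suc i) j x = ≡.cong σ (iter-+ σ i j x)

  module Automorphism {σ : Carrier → Carrier} (A : IsAutomorphism K σ) where
    open IsAutomorphism A public

    σ-0 : σ 0# ≈ 0#
    σ-0 = x+x≈x⇒x≈0 (σ 0#) (trans (sym (σ-+ 0# 0#)) (σ-cong (+-identityˡ 0#)))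

    σ-‿ : ∀ x → σ (- x) ≈ - σ x
    σ-‿ x = +-inverseʳ-unique (σ x) (σ (- x))
      (trans (sym (σ-+ x (- x))) (trans (σ-cong (-‿inverseʳ x)) σ-0))

    σ-≉0 : ∀ {x} → x ≉ 0# → σ x ≉ 0#
    σ-≉0 {x} x≉0 σx≈0 = x≉0 (σ-inj x 0# (trans σx≈0 (sym σ-0)))

    σ-inv : ∀ {x} → x ≉ 0# → σ (inv x) ≈ inv (σ x)
    σ-inv {x} x≉0 = begin
      σ (inv x)                       ≈⟨ *-identityˡ _ ⟨
      1# * σ (inv x)                  ≈⟨ *-congʳ (inv-l (σ x) (σ-≉0 x≉0)) ⟨
      (inv (σ x) * σ x) * σ (inv x)   ≈⟨ *-assoc _ _ _ ⟩
      inv (σ x) * (σ x * σ (inv x))   ≈⟨ *-congˡ (σ-* x (inv x)) ⟨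
      inv (σ x) * σ (x * inv x)       ≈⟨ *-congˡ (trans (σ-cong (inv-r x x≉0)) σ-1) ⟩
      inv (σ x) * 1#                  ≈⟨ *-identityʳ _ ⟩
      inv (σ x)                       ∎

  iter-isAutomorphism : ∀ {σ} → IsAutomorphism K σ → ∀ j → IsAutomorphism K (iter K σ j)
  iter-isAutomorphism A zero = record
    { σ-cong = λ e → e ; σ-+ = λ _ _ → refl ; σ-* = λ _ _ → refl ; σ-1 = refl ; σ-inj = λ _ _ e → e }
  iter-isAutomorphism {σ} A (suc j) = record
    { σ-cong = λ e → σ.σ-cong (σʲ.σ-cong e)
    ; σ-+    = λ x y → trans (σ.σ-cong (σʲ.σ-+ x y)) (σ.σ-+ _ _)
    ; σ-*    = λ x y → trans (σ.σ-cong (σʲ.σ-* x y)) (σ.σ-* _ _)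
    ; σ-1    = trans (σ.σ-cong σʲ.σ-1) σ.σ-1
    ; σ-inj  = λ x y e → σʲ.σ-inj x y (σ.σ-inj _ _ e)
    }
    where
      module σ  = IsAutomorphism A
      module σʲ = IsAutomorphism (iter-isAutomorphism A j)

  iter-fixed : ∀ {σ} → IsAutomorphism K σ → ∀ {c} → σ c ≈ c → ∀ j → iter K σ j c ≈ c
  iter-fixed A σc≈c zero    = refl
  iter-fixed A σc≈c (suc j) = trans (IsAutomorphism.σ-cong A (iter-fixed A σc≈c j)) σc≈c

module Modules (K : FiniteField) where
  open FieldProperties K

  record Module : Set₁ where
    infixl 6 _⊕_ _⊖_
    infixr 7 _·_
    infix  4 _≋_
    field
      V       : Set
      _≋_     : V → V → Set
      _⊕_     : V → V → V
      𝟘       : V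
      _·_     : Carrier → V → V
      ≋-refl  : ∀ {u} → u ≋ u
      ≋-sym   : ∀ {u v} → u ≋ v → v ≋ u
      ≋-trans : ∀ {u v w} → u ≋ v → v ≋ w → u ≋ w
      ⊕-cong  : ∀ {u u′ v v′} → u ≋ u′ → v ≋ v′ → u ⊕ v ≋ u′ ⊕ v′
      ·-cong  : ∀ {a a′ u u′} → a ≈ a′ → u ≋ u′ → a · u ≋ a′ · u′
      ⊕-assoc : ∀ u v w → (u ⊕ v) ⊕ w ≋ u ⊕ (v ⊕ w)
      ⊕-comm  : ∀ u v → u ⊕ v ≋ v ⊕ u
      ⊕-identityˡ : ∀ u → 𝟘 ⊕ u ≋ u
      ·-distribˡ  : ∀ a u v → a · (u ⊕ v) ≋ a · u ⊕ a · v
      ·-distribʳ  : ∀ a b u → (a + b) · u ≋ a · u ⊕ b · u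
      ·-assoc     : ∀ a b u → (a * b) · u ≋ a · (b · u)
      ·-identity  : ∀ u → 1# · u ≋ u
      ·-zero      : ∀ u → 0# · u ≋ 𝟘

    _⊖_ : V → V → V
    u ⊖ v = u ⊕ (- 1#) · v

    ·-𝟘 : ∀ a → a · 𝟘 ≋ 𝟘
    ·-𝟘 a = ≋-trans (·-cong refl (≋-sym (·-zero 𝟘)))
              (≋-trans (≋-sym (·-assoc a 0# 𝟘)) (≋-trans (·-cong (zeroʳ a) ≋-refl) (·-zero 𝟘)))

    ⊕-interchange : ∀ u v w x → (u ⊕ v) ⊕ (w ⊕ x) ≋ (u ⊕ w) ⊕ (v ⊕ x)
    ⊕-interchange u v w x =
      ≋-trans (⊕-assoc _ _ _) (≋-trans (⊕-cong ≋-refl (≋-trans (≋-sym (⊕-assoc _ _ _))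
        (≋-trans (⊕-cong (⊕-comm v w) ≋-refl) (⊕-assoc _ _ _)))) (≋-sym (⊕-assoc _ _ _)))

    lin : ∀ {k} → (Fin k → Carrier) → (Fin k → V) → V
    lin {zero}  c b = 𝟘
    lin {suc k} c b = c Fin.zero · b Fin.zero ⊕ lin (λ i → c (Fin.suc i)) (λ i → b (Fin.suc i))

    lin-cong : ∀ {k} {c c′ : Fin k → Carrier} {b b′ : Fin k → V} →
               (∀ i → c i ≈ c′ i) → (∀ i → b i ≋ b′ i) → lin c b ≋ lin c′ b′
    lin-cong {zero}  c≈c′ b≋b′ = ≋-refl
    lin-cong {suc k} c≈c′ b≋b′ = ⊕-cong (·-cong (c≈c′ Fin.zero) (b≋b′ Fin.zero))
                                   (lin-cong (λ i → c≈c′ (Fin.suc i)) (λ i → b≋b′ (Fin.suc i)))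

    lin-closed : (Scal : Carrier → Set) (W : V → Set) → W 𝟘 →
                 (∀ {u v} → W u → W v → W (u ⊕ v)) → (∀ {a u} → Scal a → W u → W (a · u)) →
                 ∀ {k} (c : Fin k → Carrier) b → (∀ i → Scal (c i)) → (∀ i → W (b i)) → W (lin c b)
    lin-closed Scal W W-𝟘 W-⊕ W-· {zero}  c b c∈ b∈ = W-𝟘
    lin-closed Scal W W-𝟘 W-⊕ W-· {suc k} c b c∈ b∈ = W-⊕ (W-· (c∈ Fin.zero) (b∈ Fin.zero))
      (lin-closed Scal W W-𝟘 W-⊕ W-· (λ i → c (Fin.suc i)) (λ i → b (Fin.suc i)) (λ i → c∈ (Fin.suc i)) (λ i → b∈ (Fin.suc i)))

    lin-+ᶜ : ∀ {k} (c c′ : Fin k → Carrier) b → lin (λ i → c i + c′ i) b ≋ lin c b ⊕ lin c′ b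
    lin-+ᶜ {zero}  c c′ b = ≋-sym (⊕-identityˡ 𝟘)
    lin-+ᶜ {suc k} c c′ b = ≋-trans
      (⊕-cong (·-distribʳ _ _ _) (lin-+ᶜ (λ i → c (Fin.suc i)) (λ i → c′ (Fin.suc i)) (λ i → b (Fin.suc i))))
      (⊕-interchange _ _ _ _)

    lin-*ᶜ : ∀ {k} a (c : Fin k → Carrier) b → lin (λ i → a * c i) b ≋ a · lin c b
    lin-*ᶜ {zero}  a c b = ≋-sym (·-𝟘 a)
    lin-*ᶜ {suc k} a c b = ≋-trans (⊕-cong (·-assoc _ _ _) (lin-*ᶜ a (λ i → c (Fin.suc i)) (λ i → b (Fin.suc i))))
                                    (≋-sym (·-distribˡ _ _ _))

    lin--ᶜ : ∀ {k} (c c′ : Fin k → Carrier) b → lin (λ i → c i - c′ i) b ≋ lin c b ⊖ lin c′ b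
    lin--ᶜ c c′ b = ≋-trans (lin-+ᶜ c (λ i → - c′ i) b)
      (⊕-cong ≋-refl (≋-trans (lin-cong (λ i → sym (-1*x≈-x (c′ i))) (λ _ → ≋-refl)) (lin-*ᶜ (- 1#) c′ b)))

    lin-*· : ∀ {k} (c d : Fin k → Carrier) b → lin (λ i → c i * d i) b ≋ lin c (λ i → d i · b i)
    lin-*· {zero}  c d b = ≋-refl
    lin-*· {suc k} c d b = ⊕-cong (·-assoc _ _ _) (lin-*· (λ i → c (Fin.suc i)) (λ i → d (Fin.suc i)) (λ i → b (Fin.suc i)))

    sum : ℕ → (ℕ → V) → V
    sum zero    f = 𝟘
    sum (suc m) f = f 0 ⊕ sum m (λ j → f (suc j))

    sum-cong : ∀ m {f g : ℕ → V} → (∀ j → f j ≋ g j) → sum m f ≋ sum m g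
    sum-cong zero    f≋g = ≋-refl
    sum-cong (suc m) f≋g = ⊕-cong (f≋g 0) (sum-cong m (λ j → f≋g (suc j)))

    sum-suc : ∀ m f → sum (suc m) f ≋ sum m f ⊕ f m
    sum-suc zero    f = ⊕-comm _ _
    sum-suc (suc m) f = ≋-trans (⊕-cong ≋-refl (sum-suc m (λ j → f (suc j)))) (≋-sym (⊕-assoc _ _ _))

    sum-rotate : ∀ m f → f m ≋ f 0 → sum m (λ j → f (suc j)) ≋ sum m f
    sum-rotate zero    f fm≋f0 = ≋-refl
    sum-rotate (suc m) f fm≋f0 =
      ≋-trans (sum-suc m (λ j → f (suc j))) (≋-trans (⊕-cong ≋-refl fm≋f0) (⊕-comm _ _))

    lin≋sum : ∀ m (g : ℕ → Carrier) (f : ℕ → V) →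
              lin (λ (j : Fin m) → g (toℕ j)) (λ j → f (toℕ j)) ≋ sum m (λ j → g j · f j)
    lin≋sum zero    g f = ≋-refl
    lin≋sum (suc m) g f = ⊕-cong ≋-refl (lin≋sum m (λ j → g (suc j)) (λ j → f (suc j)))

  lin-semilinear : (M₁ M₂ : Module) (ρ : Carrier → Carrier) (f : Module.V M₁ → Module.V M₂) →
    let open Module M₁ using () renaming (_≋_ to _≋₁_; _⊕_ to _⊕₁_; _·_ to _·₁_; 𝟘 to 𝟘₁; lin to lin₁)
        open Module M₂ using () renaming (_≋_ to _≋₂_; _⊕_ to _⊕₂_; _·_ to _·₂_; 𝟘 to 𝟘₂; lin to lin₂)
    in (∀ u v → f (u ⊕₁ v) ≋₂ f u ⊕₂ f v) → (∀ a u → f (a ·₁ u) ≋₂ ρ a ·₂ f u) → f 𝟘₁ ≋₂ 𝟘₂ →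
       ∀ {k} (c : Fin k → Carrier) b → f (lin₁ c b) ≋₂ lin₂ (λ i → ρ (c i)) (λ i → f (b i))
  lin-semilinear M₁ M₂ ρ f f-⊕ f-· f-𝟘 {zero}  c b = f-𝟘
  lin-semilinear M₁ M₂ ρ f f-⊕ f-· f-𝟘 {suc k} c b = Module.≋-trans M₂ (f-⊕ _ _)
    (Module.⊕-cong M₂ (f-· _ _) (lin-semilinear M₁ M₂ ρ f f-⊕ f-· f-𝟘 (λ i → c (Fin.suc i)) (λ i → b (Fin.suc i))))

  Vector : ℕ → Set
  Vector D = Fin D → Carrier

  infix 4 _≈ᵛ_
  _≈ᵛ_ : ∀ {D} → Vector D → Vector D → Set
  u ≈ᵛ v = ∀ i → u i ≈ v i

  vectorModule : ℕ → Module
  vectorModule D = record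
    { V = Vector D ; _≋_ = _≈ᵛ_ ; _⊕_ = λ u v i → u i + v i ; 𝟘 = λ _ → 0# ; _·_ = λ c v i → c * v i
    ; ≋-refl = λ i → refl ; ≋-sym = λ e i → sym (e i) ; ≋-trans = λ e f i → trans (e i) (f i)
    ; ⊕-cong = λ e f i → +-cong (e i) (f i) ; ·-cong = λ e f i → *-cong e (f i)
    ; ⊕-assoc = λ u v w i → +-assoc _ _ _ ; ⊕-comm = λ u v i → +-comm _ _ ; ⊕-identityˡ = λ u i → +-identityˡ _
    ; ·-distribˡ = λ a u v i → distribˡ _ _ _ ; ·-distribʳ = λ a b u i → distribʳ _ _ _
    ; ·-assoc = λ a b u i → *-assoc _ _ _ ; ·-identity = λ u i → *-identityˡ _ ; ·-zero = λ u i → zeroˡ _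
    }

  fieldModule : Module
  fieldModule = record
    { V = Carrier ; _≋_ = _≈_ ; _⊕_ = _+_ ; 𝟘 = 0# ; _·_ = _*_
    ; ≋-refl = refl ; ≋-sym = sym ; ≋-trans = trans ; ⊕-cong = +-cong ; ·-cong = *-cong
    ; ⊕-assoc = +-assoc ; ⊕-comm = +-comm ; ⊕-identityˡ = +-identityˡ
    ; ·-distribˡ = distribˡ ; ·-distribʳ = λ a b u → distribʳ u a b
    ; ·-assoc = *-assoc ; ·-identity = *-identityˡ ; ·-zero = zeroˡ
    }

  lin-apply : ∀ {D k} (c : Fin k → Carrier) (b : Fin k → Vector D) i →
              Module.lin (vectorModule D) c b i ≈ Module.lin fieldModule c (λ j → b j i)
  lin-apply {k = zero}  c b i = refl
  lin-apply {k = suc k} c b i = +-congˡ (lin-apply (λ j → c (Fin.suc j)) (λ j → b (Fin.suc j)) i)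

  module _ (M : Module) (Scal : Carrier → Set) where
    open Module M

    Independent : ∀ {k} → (Fin k → V) → Set
    Independent b = ∀ c → (∀ i → Scal (c i)) → lin c b ≋ 𝟘 → ∀ i → c i ≈ 0#

    _Spans_ : ∀ {k} → (Fin k → V) → (V → Set) → Set
    b Spans W = ∀ v → W v → ∃ λ c → (∀ i → Scal (c i)) × (v ≋ lin c b)

    record Basis (W : V → Set) (k : ℕ) : Set where
      field
        vec         : Fin k → V
        vec∈W       : ∀ i → W (vec i)
        independent : Independent vec
        spanning    : vec Spans W

    module _ (W : V → Set) where
      private
        -- HasDim's linear combination is local to its where-block; unification recovers it.
        ShapeOfHasDim : ∀ {k} → ((Fin k → Carrier) → (Fin k → V) → V) → Set
        ShapeOfHasDim {k} lin′ = Σ (Fin k → V) λ b → (∀ i → W (b i))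
          × (∀ (c : Fin k → Carrier) → (∀ i → Scal (c i)) → lin′ c b ≋ 𝟘 → ∀ i → c i ≈ 0#)
          × (∀ v → W v → ∃ λ (c : Fin k → Carrier) → (∀ i → Scal (c i)) × (v ≋ lin′ c b))

        hasDimLin : ∀ {k} → Σ _ λ lin′ → HasDim K _≋_ _⊕_ 𝟘 _·_ Scal W k ≡ ShapeOfHasDim lin′
        hasDimLin = _ , ≡.refl

        hasDimLin≡lin : ∀ {k} c b → proj₁ (hasDimLin {k}) c b ≡ lin c b
        hasDimLin≡lin {zero}  c b = ≡.refl
        hasDimLin≡lin {suc k} c b = ≡.cong (c Fin.zero · b Fin.zero ⊕_) (hasDimLin≡lin (λ i → c (Fin.suc i)) (λ i → b (Fin.suc i)))

      hasDim⇒basis : ∀ {k} → HasDim K _≋_ _⊕_ 𝟘 _·_ Scal W k → Basis W k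
      hasDim⇒basis (b , b∈W , ind , sp) = record
        { vec = b ; vec∈W = b∈W
        ; independent = λ c c∈ lin≋𝟘 → ind c c∈ (≡.subst (_≋ 𝟘) (≡.sym (hasDimLin≡lin c b)) lin≋𝟘)
        ; spanning = λ v v∈W → let (c , c∈ , v≋) = sp v v∈W in c , c∈ , ≡.subst (v ≋_) (hasDimLin≡lin c b) v≋
        }

      basis⇒hasDim : ∀ {k} → Basis W k → HasDim K _≋_ _⊕_ 𝟘 _·_ Scal W k
      basis⇒hasDim B = vec , vec∈W
        , (λ c c∈ lin≋𝟘 → independent c c∈ (≡.subst (_≋ 𝟘) (hasDimLin≡lin c vec) lin≋𝟘))
        , λ v v∈W → let (c , c∈ , v≋) = spanning v v∈W in c , c∈ , ≡.subst (v ≋_) (≡.sym (hasDimLin≡lin c vec)) v≋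
        where open Basis B

𝟙 : {A : Set} → Dec A → ℕ
𝟙 (yes _) = 1
𝟙 (no _)  = 0

𝟙-⇔ : {A B : Set} (a? : Dec A) (b? : Dec B) → (A → B) → (B → A) → 𝟙 a? ≡ 𝟙 b?
𝟙-⇔ (yes a) (yes b) f g = ≡.refl
𝟙-⇔ (yes a) (no ¬b) f g = ⊥-elim (¬b (f a))
𝟙-⇔ (no ¬a) (yes b) f g = ⊥-elim (¬a (g b))
𝟙-⇔ (no ¬a) (no ¬b) f g = ≡.refl

𝟙≤1 : {A : Set} (a? : Dec A) → 𝟙 a? ≤ 1
𝟙≤1 (yes _) = s≤s z≤n
𝟙≤1 (no _)  = z≤n

𝟙-yes : {A : Set} (a? : Dec A) → A → 𝟙 a? ≡ 1
𝟙-yes (yes _) a = ≡.refl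
𝟙-yes (no ¬a) a = ⊥-elim (¬a a)

𝟙-no : {A : Set} (a? : Dec A) → ¬ A → 𝟙 a? ≡ 0
𝟙-no (yes a) ¬a = ⊥-elim (¬a a)
𝟙-no (no _)  ¬a = ≡.refl

∑ℕ-const : ∀ N c → ∑[ i < N ] c ≡ N ℕ.* c
∑ℕ-const zero    c = ≡.refl
∑ℕ-const (suc N) c = ≡.cong (c ℕ.+_) (∑ℕ-const N c)

∑ℕ-*ˡ : ∀ N c (f : Fin N → ℕ) → ∑[ i < N ] (c ℕ.* f i) ≡ c ℕ.* ∑[ i < N ] f i
∑ℕ-*ˡ zero    c f = ≡.sym (ℕₚ.*-zeroʳ c)
∑ℕ-*ˡ (suc N) c f = ≡.trans (≡.cong (c ℕ.* f Fin.zero ℕ.+_) (∑ℕ-*ˡ N c (f ∘ Fin.suc)))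
                          (≡.sym (ℕₚ.*-distribˡ-+ c _ _))

∑ℕ-mono-≤ : ∀ N {f g : Fin N → ℕ} → (∀ i → f i ≤ g i) → ∑[ i < N ] f i ≤ ∑[ i < N ] g i
∑ℕ-mono-≤ zero    f≤g = z≤n
∑ℕ-mono-≤ (suc N) f≤g = ℕₚ.+-mono-≤ (f≤g Fin.zero) (∑ℕ-mono-≤ N (λ i → f≤g (Fin.suc i)))

∑ℕ-𝟙-≡ : ∀ N (i₀ : Fin N) → ∑[ i < N ] 𝟙 (i Fin.≟ i₀) ≡ 1
∑ℕ-𝟙-≡ (suc N) Fin.zero = ≡.cong suc (≡.trans
  (sum-cong-≗ {N} (λ i → 𝟙-no (Fin.suc i Fin.≟ Fin.zero) (λ ()))) (≡.trans (∑ℕ-const N 0) (ℕₚ.*-zeroʳ N)))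
∑ℕ-𝟙-≡ (suc N) (Fin.suc i₀) = ≡.trans
  (≡.cong₂ ℕ._+_ (𝟙-no (Fin.zero Fin.≟ Fin.suc i₀) (λ ()))
                 (sum-cong-≗ {N} (λ i → 𝟙-⇔ (Fin.suc i Fin.≟ Fin.suc i₀) (i Fin.≟ i₀) Finₚ.suc-injective (≡.cong Fin.suc))))
  (∑ℕ-𝟙-≡ N i₀)

module Counting (K : FiniteField) where
  open FieldProperties K
  open Modules K

  record Enumerated : Set₁ where
    field
      Member      : Carrier → Set
      count       : ℕ
      card        : HasCard K Member count

    element : Fin count → Carrier
    element = proj₁ card

    element∈ : ∀ i → Member (element i)
    element∈ = proj₁ (proj₂ card)

    element-injective : ∀ i j → element i ≈ element j → i ≡ j
    element-injective = proj₁ (proj₂ (proj₂ card))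

    element-surjective : ∀ x → Member x → ∃ λ i → element i ≈ x
    element-surjective = proj₂ (proj₂ (proj₂ card))

  allOfK : Enumerated
  allOfK = record
    { Member = λ _ → ⊤ ; count = size ; card = enum , (λ _ → tt) , enum-inj , (λ x _ → enum-surj x) }

  infix 4 _≟ᵛ_
  _≟ᵛ_ : ∀ {D} (u v : Vector D) → Dec (u ≈ᵛ v)
  u ≟ᵛ v = Finₚ.all? (λ i → u i ≟ v i)

  module VectorSums (E : Enumerated) where
    open Enumerated E

    Members : ∀ {D} → Vector D → Set
    Members v = ∀ i → Member (v i)

    element∷-Members : ∀ {D} i (v : Vector D) → Members v → Members (element i ∷ v)
    element∷-Members i v v∈ Fin.zero    = element∈ i
    element∷-Members i v v∈ (Fin.suc j) = v∈ j

    ∑ᵛ : (D : ℕ) → (Vector D → ℕ) → ℕ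
    ∑ᵛ zero    f = f []
    ∑ᵛ (suc D) f = ∑[ i < count ] ∑ᵛ D (λ v → f (element i ∷ v))

    ∑ᵛ-cong : ∀ D {f g : Vector D → ℕ} → (∀ v → Members v → f v ≡ g v) → ∑ᵛ D f ≡ ∑ᵛ D g
    ∑ᵛ-cong zero    f≡g = f≡g [] (λ ())
    ∑ᵛ-cong (suc D) f≡g = sum-cong-≗ {count} (λ i → ∑ᵛ-cong D (λ v v∈ → f≡g _ (element∷-Members i v v∈)))

    ∑ᵛ-mono-≤ : ∀ D {f g : Vector D → ℕ} → (∀ v → Members v → f v ≤ g v) → ∑ᵛ D f ≤ ∑ᵛ D g
    ∑ᵛ-mono-≤ zero    f≤g = f≤g [] (λ ())
    ∑ᵛ-mono-≤ (suc D) f≤g = ∑ℕ-mono-≤ count (λ i → ∑ᵛ-mono-≤ D (λ v v∈ → f≤g _ (element∷-Members i v v∈)))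

    ∑ᵛ-const : ∀ D c → ∑ᵛ D (λ _ → c) ≡ count ^ D ℕ.* c
    ∑ᵛ-const zero    c = ≡.sym (ℕₚ.+-identityʳ c)
    ∑ᵛ-const (suc D) c = ≡.trans (sum-cong-≗ {count} (λ i → ∑ᵛ-const D c))
      (≡.trans (∑ℕ-const count _) (≡.sym (ℕₚ.*-assoc count (count ^ D) c)))

    ∑ᵛ-distrib-+ : ∀ D (f g : Vector D → ℕ) → ∑ᵛ D (λ v → f v ℕ.+ g v) ≡ ∑ᵛ D f ℕ.+ ∑ᵛ D g
    ∑ᵛ-distrib-+ zero    f g = ≡.refl
    ∑ᵛ-distrib-+ (suc D) f g = ≡.trans (sum-cong-≗ {count} (λ i → ∑ᵛ-distrib-+ D _ _))
      (∑ℕ-distrib-+ (λ i → ∑ᵛ D (λ v → f (element i ∷ v))) (λ i → ∑ᵛ D (λ v → g (element i ∷ v))))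

    ∑ᵛ-*ˡ : ∀ D c (f : Vector D → ℕ) → ∑ᵛ D (λ v → c ℕ.* f v) ≡ c ℕ.* ∑ᵛ D f
    ∑ᵛ-*ˡ zero    c f = ≡.refl
    ∑ᵛ-*ˡ (suc D) c f = ≡.trans (sum-cong-≗ {count} (λ i → ∑ᵛ-*ˡ D c _)) (∑ℕ-*ˡ count c _)

    ∑ᵛ-∑-comm : ∀ D N (f : Vector D → Fin N → ℕ) → ∑ᵛ D (λ v → ∑[ j < N ] f v j) ≡ ∑[ j < N ] ∑ᵛ D (λ v → f v j)
    ∑ᵛ-∑-comm zero    N f = ≡.refl
    ∑ᵛ-∑-comm (suc D) N f = ≡.trans (sum-cong-≗ {count} (λ i → ∑ᵛ-∑-comm D N _))
      (∑ℕ-comm (λ i j → ∑ᵛ D (λ v → f (element i ∷ v) j)))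

    ∑-𝟙-≈ : ∀ x → Member x → ∑[ i < count ] 𝟙 (element i ≟ x) ≡ 1
    ∑-𝟙-≈ x x∈ with element-surjective x x∈
    ... | i₀ , eᵢ₀≈x = ≡.trans
      (sum-cong-≗ {count} (λ i → 𝟙-⇔ (element i ≟ x) (i Fin.≟ i₀)
        (λ eᵢ≈x → element-injective i i₀ (trans eᵢ≈x (sym eᵢ₀≈x)))
        (λ i≡i₀ → trans (reflexive (≡.cong element i≡i₀)) eᵢ₀≈x)))
      (∑ℕ-𝟙-≡ count i₀)

    ∑ᵛ-𝟙-≈ᵛ : ∀ D (u : Vector D) → Members u → ∑ᵛ D (λ v → 𝟙 (v ≟ᵛ u)) ≡ 1
    ∑ᵛ-𝟙-≈ᵛ zero    u u∈ = 𝟙-yes ([] ≟ᵛ u) (λ ())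
    ∑ᵛ-𝟙-≈ᵛ (suc D) u u∈ = ≡.trans
      (sum-cong-≗ {count} λ i → ≡.trans (∑ᵛ-cong D (λ v _ → 𝟙-∷ i v))
        (≡.trans (∑ᵛ-*ˡ D (𝟙 (element i ≟ u Fin.zero)) (λ v → 𝟙 (v ≟ᵛ tail u)))
        (≡.trans (≡.cong (𝟙 (element i ≟ u Fin.zero) ℕ.*_) (∑ᵛ-𝟙-≈ᵛ D (tail u) (u∈ ∘ Fin.suc)))
                 (ℕₚ.*-identityʳ _))))
      (∑-𝟙-≈ (u Fin.zero) (u∈ Fin.zero))
      where
        𝟙-∷ : ∀ i (v : Vector D) → 𝟙 ((element i ∷ v) ≟ᵛ u) ≡ 𝟙 (element i ≟ u Fin.zero) ℕ.* 𝟙 (v ≟ᵛ tail u)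
        𝟙-∷ i v = 𝟙-head-tail (element i ≟ u Fin.zero) (v ≟ᵛ tail u)
          where
            𝟙-head-tail : (h? : Dec (element i ≈ u Fin.zero)) (t? : Dec (v ≈ᵛ tail u)) →
                          𝟙 ((element i ∷ v) ≟ᵛ u) ≡ 𝟙 h? ℕ.* 𝟙 t?
            𝟙-head-tail (yes h) (yes t) = 𝟙-yes ((element i ∷ v) ≟ᵛ u) (λ { Fin.zero → h ; (Fin.suc j) → t j })
            𝟙-head-tail (yes h) (no ¬t) = 𝟙-no ((element i ∷ v) ≟ᵛ u) (λ e → ¬t (e ∘ Fin.suc))
            𝟙-head-tail (no ¬h) _       = 𝟙-no ((element i ∷ v) ≟ᵛ u) (λ e → ¬h (e Fin.zero))

    any?ᵛ : ∀ D (R : Vector D → Set) → (∀ v → Dec (R v)) → (∀ {v v′} → v ≈ᵛ v′ → R v → R v′) →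
            Dec (∃ λ v → Members v × R v)
    any?ᵛ zero R R? R-resp with R? []
    ... | yes r = yes ([] , (λ ()) , r)
    ... | no ¬r = no λ (v , _ , r) → ¬r (R-resp (λ ()) r)
    any?ᵛ (suc D) R R? R-resp with Finₚ.any? (λ i → any?ᵛ D (λ v → R (element i ∷ v)) (λ v → R? (element i ∷ v))
                                                 (λ e → R-resp λ { Fin.zero → refl ; (Fin.suc j) → e j }))
    ... | yes (i , v , v∈ , r) = yes (element i ∷ v , element∷-Members i v v∈ , r)
    ... | no ¬∃ = no λ (v , v∈ , r) → let (i , eᵢ≈) = element-surjective (v Fin.zero) (v∈ Fin.zero) in
            ¬∃ (i , tail v , v∈ ∘ Fin.suc , R-resp (λ { Fin.zero → sym eᵢ≈ ; (Fin.suc j) → refl }) r)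

  open VectorSums allOfK public using () renaming (∑ᵛ to ∑ᴷ; ∑ᵛ-cong to ∑ᴷ-cong; ∑ᵛ-const to ∑ᴷ-const)

  ∑ᵛ-comm : (E₁ E₂ : Enumerated) → ∀ D₁ D₂ (f : Vector D₁ → Vector D₂ → ℕ) →
            VectorSums.∑ᵛ E₁ D₁ (λ v → VectorSums.∑ᵛ E₂ D₂ (f v)) ≡ VectorSums.∑ᵛ E₂ D₂ (λ w → VectorSums.∑ᵛ E₁ D₁ (λ v → f v w))
  ∑ᵛ-comm E₁ E₂ zero      D₂ f = ≡.refl
  ∑ᵛ-comm E₁ E₂ (suc D₁) D₂ f = ≡.trans (sum-cong-≗ {Enumerated.count E₁} (λ i → ∑ᵛ-comm E₁ E₂ D₁ D₂ _))
                                        (≡.sym (VectorSums.∑ᵛ-∑-comm E₂ D₂ (Enumerated.count E₁) _))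

  module _ (E : Enumerated) {k D : ℕ} (f : Vector k → Vector D) where
    open Enumerated E using (count)
    open VectorSums E
    private module Sᴷ = VectorSums allOfK

    InImage : Vector D → Set
    InImage v = ∃ λ c → Members c × f c ≈ᵛ v

    ∑ᴷ-𝟙-image : (∀ {c c′} → c ≈ᵛ c′ → f c ≈ᵛ f c′) →
                 (∀ {c c′} → Members c → Members c′ → f c ≈ᵛ f c′ → c ≈ᵛ c′) →
                 (Q : Vector D → Set) (Q? : ∀ v → Dec (Q v)) →
                 (∀ v → Q v → InImage v) → (∀ v → InImage v → Q v) →
                 ∑ᴷ D (λ v → 𝟙 (Q? v)) ≡ count ^ k
    ∑ᴷ-𝟙-image f-cong f-injective Q Q? Q⇒image image⇒Q = ≡.trans
      (∑ᴷ-cong D (λ v _ → 𝟙-Q v (Q? v))) (≡.trans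
      (∑ᵛ-comm allOfK E D k (λ v c → 𝟙 (f c ≟ᵛ v))) (≡.trans
      (∑ᵛ-cong k (λ c _ → ≡.trans (Sᴷ.∑ᵛ-cong D (λ v _ → 𝟙-⇔ (f c ≟ᵛ v) (v ≟ᵛ f c) (λ e i → sym (e i)) (λ e i → sym (e i))))
                                 (Sᴷ.∑ᵛ-𝟙-≈ᵛ D (f c) (λ _ → tt))))
      (≡.trans (∑ᵛ-const k 1) (ℕₚ.*-identityʳ _))))
      where
        𝟙-Q : ∀ v (q? : Dec (Q v)) → 𝟙 q? ≡ ∑ᵛ k (λ c → 𝟙 (f c ≟ᵛ v))
        𝟙-Q v (yes q) with Q⇒image v q
        ... | c₀ , c₀∈ , fc₀≈v = ≡.sym (≡.trans
          (∑ᵛ-cong k (λ c c∈ → 𝟙-⇔ (f c ≟ᵛ v) (c ≟ᵛ c₀)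
            (λ fc≈v → f-injective c∈ c₀∈ (λ i → trans (fc≈v i) (sym (fc₀≈v i))))
            (λ c≈c₀ i → trans (f-cong c≈c₀ i) (fc₀≈v i))))
          (∑ᵛ-𝟙-≈ᵛ k c₀ c₀∈))
        𝟙-Q v (no ¬q) = ≡.sym (≡.trans
          (∑ᵛ-cong k (λ c c∈ → 𝟙-no (f c ≟ᵛ v) (λ fc≈v → ¬q (image⇒Q v (c , c∈ , fc≈v)))))
          (≡.trans (∑ᵛ-const k 0) (ℕₚ.*-zeroʳ (count ^ k))))

n<s^n : ∀ s → 2 ≤ s → ∀ n → n < s ^ n
n<s^n s 2≤s zero    = s≤s z≤n
n<s^n s 2≤s (suc n) = ℕₚ.≤-trans (s≤s (n<s^n s 2≤s n)) (ℕₚ.≤-trans 1+s^n≤2*s^n (ℕₚ.*-monoˡ-≤ (s ^ n) 2≤s))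
  where
    1+s^n≤2*s^n : suc (s ^ n) ≤ 2 ℕ.* s ^ n
    1+s^n≤2*s^n = ℕₚ.≤-trans (s≤s (ℕₚ.≤-reflexive (≡.sym (ℕₚ.+-identityʳ (s ^ n)))))
                             (ℕₚ.+-monoˡ-≤ (s ^ n ℕ.+ 0) (ℕₚ.≤-trans (s≤s z≤n) (n<s^n s 2≤s n)))

^-injectiveʳ : ∀ s → 2 ≤ s → ∀ {m n} → s ^ m ≡ s ^ n → m ≡ n
^-injectiveʳ s 2≤s {m} {n} s^m≡s^n with ℕₚ.<-cmp m n
... | tri< m<n _ _ = ⊥-elim (ℕₚ.<-irrefl s^m≡s^n (ℕₚ.^-monoʳ-< s 2≤s m<n))
... | tri≈ _ m≡n _ = m≡n
... | tri> _ _ n<m = ⊥-elim (ℕₚ.<-irrefl (≡.sym s^m≡s^n) (ℕₚ.^-monoʳ-< s 2≤s n<m))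

module Bases (K : FiniteField) where
  open FieldProperties K
  open Modules K
  open Counting K

  record IsSubfield (E : Enumerated) : Set where
    open Enumerated E
    field
      0∈   : Member 0#
      1∈   : Member 1#
      +-∈  : ∀ {x y} → Member x → Member y → Member (x + y)
      *-∈  : ∀ {x y} → Member x → Member y → Member (x * y)
      -‿∈  : ∀ {x} → Member x → Member (- x)
      inv-∈ : ∀ {x} → x ≉ 0# → Member x → Member (inv x)

  allOfK-isSubfield : IsSubfield allOfK
  allOfK-isSubfield = record
    { 0∈ = tt ; 1∈ = tt ; +-∈ = λ _ _ → tt ; *-∈ = λ _ _ → tt ; -‿∈ = λ _ → tt ; inv-∈ = λ _ _ → tt }

  module _ (E : Enumerated) (E-subfield : IsSubfield E) where
    open Enumerated E
    open IsSubfield E-subfield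
    open VectorSums E

    2≤count : 2 ≤ count
    2≤count with element-surjective 0# 0∈ | element-surjective 1# 1∈
    ... | i₀ , e≈0 | i₁ , e≈1 =
      two-distinct i₀ i₁ (λ i₀≡i₁ → 0≉1 (trans (sym e≈0) (trans (reflexive (≡.cong element i₀≡i₁)) e≈1)))
      where
        two-distinct : ∀ {n} (i j : Fin n) → i ≢ j → 2 ≤ n
        two-distinct {suc zero}    Fin.zero Fin.zero i≢j = ⊥-elim (i≢j ≡.refl)
        two-distinct {suc (suc n)} _        _        _   = s≤s (s≤s z≤n)

    module _ {D : ℕ} where
      open Module (vectorModule D) using (lin; lin-cong; lin--ᶜ; lin-*ᶜ)

      InSpan : ∀ {j} → (Fin j → Vector D) → Vector D → Set
      InSpan b v = ∃ λ c → Members c × lin c b ≈ᵛ v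

      InSpan? : ∀ {j} (b : Fin j → Vector D) v → Dec (InSpan b v)
      InSpan? {j} b v = any?ᵛ j (λ c → lin c b ≈ᵛ v) (λ c → lin c b ≟ᵛ v)
                          (λ c≈c′ e i → trans (sym (lin-cong c≈c′ (λ _ _ → refl) i)) (e i))

      independent⇒lin-injective : ∀ {j} {b : Fin j → Vector D} → Independent (vectorModule D) Member b →
        ∀ {c c′} → Members c → Members c′ → lin c b ≈ᵛ lin c′ b → c ≈ᵛ c′
      independent⇒lin-injective {b = b} ind {c} {c′} c∈ c′∈ e i = x∙y⁻¹≈ε⇒x≈y _ _
        (ind (λ i → c i - c′ i) (λ i → +-∈ (c∈ i) (-‿∈ (c′∈ i)))
             (λ x → trans (lin--ᶜ c c′ b x) (trans (+-congˡ (-1*x≈-x _)) (x≈y⇒x∙y⁻¹≈ε (e x)))) i)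

      ∑ᴷ-𝟙-span : ∀ {j} (b : Fin j → Vector D) → Independent (vectorModule D) Member b →
                  ∑ᴷ D (λ v → 𝟙 (InSpan? b v)) ≡ count ^ j
      ∑ᴷ-𝟙-span b ind = ∑ᴷ-𝟙-image E (λ c → lin c b) (λ c≈c′ → lin-cong c≈c′ (λ _ _ → refl))
        (independent⇒lin-injective ind) (InSpan b) (InSpan? b) (λ _ h → h) (λ _ h → h)

      count^≤size^ : ∀ {j} (b : Fin j → Vector D) → Independent (vectorModule D) Member b → count ^ j ≤ size ^ D
      count^≤size^ b ind = ≡.subst (_≤ size ^ D) (∑ᴷ-𝟙-span b ind)
        (ℕₚ.≤-trans (VectorSums.∑ᵛ-mono-≤ allOfK D (λ v _ → 𝟙≤1 (InSpan? b v)))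
                    (ℕₚ.≤-reflexive (≡.trans (∑ᴷ-const D 1) (ℕₚ.*-identityʳ _))))

      independent-∷ : ∀ {j} (b : Fin j → Vector D) v → Independent (vectorModule D) Member b → ¬ InSpan b v →
                      Independent (vectorModule D) Member (v ∷ b)
      independent-∷ b v ind v∉ c c∈ lin≈0 with c Fin.zero ≟ 0#
      ... | yes c₀≈0 = λ { Fin.zero → c₀≈0 ; (Fin.suc i) → rest i }
        where
          rest : ∀ i → c (Fin.suc i) ≈ 0#
          rest = ind (c ∘ Fin.suc) (c∈ ∘ Fin.suc) λ x →
            trans (sym (+-identityˡ _)) (trans (+-congʳ (sym (trans (*-congʳ c₀≈0) (zeroˡ (v x))))) (lin≈0 x))
      ... | no c₀≉0 = ⊥-elim (v∉ (c′ , c′∈ , v≈))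
        where
          c′ : Fin _ → Carrier
          c′ i = - inv (c Fin.zero) * c (Fin.suc i)
          c′∈ : Members c′
          c′∈ i = *-∈ (-‿∈ (inv-∈ c₀≉0 (c∈ Fin.zero))) (c∈ (Fin.suc i))
          v≈ : lin c′ b ≈ᵛ v
          v≈ x = trans (lin-*ᶜ (- inv (c Fin.zero)) (c ∘ Fin.suc) b x)
                 (trans (sym (-‿distribˡ-* _ _)) (sym (c*x+y≈0⇒x≈-[c⁻¹*y] c₀≉0 (lin≈0 x))))

      module _ (W : Vector D → Set) (W? : ∀ v → Dec (W v)) (W-resp : ∀ {v v′} → v ≈ᵛ v′ → W v → W v′) where

        private
          Outside : ∀ {j} → (Fin j → Vector D) → Vector D → Set
          Outside b v = W v × ¬ InSpan b v

          Outside? : ∀ {j} (b : Fin j → Vector D) v → Dec (Outside b v)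
          Outside? b v with W? v | InSpan? b v
          ... | yes w | yes v∈ = no λ (_ , v∉) → v∉ v∈
          ... | yes w | no v∉  = yes (w , v∉)
          ... | no ¬w | _      = no λ (w , _) → ¬w w

          Outside-resp : ∀ {j} (b : Fin j → Vector D) {v v′} → v ≈ᵛ v′ → Outside b v → Outside b v′
          Outside-resp b v≈v′ (w , v∉) = W-resp v≈v′ w , λ (c , c∈ , e) → v∉ (c , c∈ , λ i → trans (e i) (sym (v≈v′ i)))

          -- The fuel suffices because an independent family of length j has count ^ j ≤ size ^ D.
          extend : ∀ fuel j → j ℕ.+ fuel ≡ suc (size ^ D) → (b : Fin j → Vector D) → (∀ i → W (b i)) →
                   Independent (vectorModule D) Member b → ∃ (Basis (vectorModule D) Member W)
          extend zero j j+0≡ b b∈W ind = ⊥-elim (ℕₚ.<-asym j<size^D (ℕₚ.≤-reflexive (≡.sym j≡)))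
            where
              j≡ : j ≡ suc (size ^ D)
              j≡ = ≡.trans (≡.sym (ℕₚ.+-identityʳ j)) j+0≡
              j<size^D : j < size ^ D
              j<size^D = ℕₚ.<-≤-trans (n<s^n count 2≤count j) (count^≤size^ b ind)
          extend (suc fuel) j j≡ b b∈W ind with VectorSums.any?ᵛ allOfK D (Outside b) (Outside? b) (Outside-resp b)
          ... | yes (v , _ , v∈W , v∉) = extend fuel (suc j) (≡.trans (≡.sym (ℕₚ.+-suc j fuel)) j≡) (v ∷ b)
                                            (λ { Fin.zero → v∈W ; (Fin.suc i) → b∈W i }) (independent-∷ b v ind v∉)
          ... | no nothing-outside = j , record
            { vec = b ; vec∈W = b∈W ; independent = ind
            ; spanning = λ v v∈W → spans v v∈W (InSpan? b v) }
            where
              spans : ∀ v → W v → Dec (InSpan b v) → ∃ λ c → Members c × (v ≈ᵛ lin c b)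
              spans v v∈W (yes (c , c∈ , e)) = c , c∈ , λ i → sym (e i)
              spans v v∈W (no v∉)            = ⊥-elim (nothing-outside (v , (λ _ → tt) , v∈W , v∉))

        basis-exists : ∃ (Basis (vectorModule D) Member W)
        basis-exists = extend (suc (size ^ D)) 0 ≡.refl (λ ()) (λ ()) (λ c _ _ ())

        ∑ᴷ-𝟙-basis : ∀ {k} (B : Basis (vectorModule D) Member W k) →
                     (∀ c → Members c → W (lin c (Basis.vec B))) → ∑ᴷ D (λ v → 𝟙 (W? v)) ≡ count ^ k
        ∑ᴷ-𝟙-basis B lin∈W = ∑ᴷ-𝟙-image E (λ c → lin c vec) (λ c≈c′ → lin-cong c≈c′ (λ _ _ → refl))
          (independent⇒lin-injective independent) W W?
          (λ v v∈W → let (c , c∈ , v≈) = spanning v v∈W in c , c∈ , λ i → sym (v≈ i))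
          (λ v (c , c∈ , e) → W-resp e (lin∈W c c∈))
          where open Basis B

        basis-from-count : (∀ {j} (b : Fin j → Vector D) → (∀ i → W (b i)) → ∀ c → Members c → W (lin c b)) →
                           ∀ {k} → ∑ᴷ D (λ v → 𝟙 (W? v)) ≡ count ^ k → Basis (vectorModule D) Member W k
        basis-from-count lin∈W {k} #W≡count^k = ≡.subst (Basis (vectorModule D) Member W) k′≡k B
          where
            k′ = proj₁ basis-exists
            B = proj₂ basis-exists
            k′≡k : k′ ≡ k
            k′≡k = ^-injectiveʳ count 2≤count (≡.trans (≡.sym (∑ᴷ-𝟙-basis B (lin∈W (Basis.vec B) (Basis.vec∈W B)))) #W≡count^k)

module Dedekind (K : FiniteField) where
  open FieldProperties K
  open SetoidReasoning setoid
  open Automorphisms K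
  open Modules K

  Distinct : ∀ {r} → (Fin r → Carrier → Carrier) → Set
  Distinct τ = ∀ i j → i ≢ j → ∃ λ y → τ i y ≉ τ j y

  module _ {D : ℕ} (U : Vector D → Set)
           (U-resp : ∀ {u v} → u ≈ᵛ v → U u → U v)
           (U-+ : ∀ {u v} → U u → U v → U (λ i → u i + v i))
           (U-* : ∀ a {u} → U u → U (λ i → a * u i)) where
    open Module (vectorModule D) using (lin; lin-cong; lin--ᶜ; lin-*ᶜ; lin-*·; _⊖_; _·_)

    CombinationsIn-U : ∀ {r} → (Fin r → Carrier → Carrier) → (Fin r → Vector D) → Set
    CombinationsIn-U τ u = ∀ c → U (lin (λ j → τ j c) u)

    U-⊖ : ∀ {u v} → U u → U v → U (u ⊖ v)
    U-⊖ u∈ v∈ = U-+ u∈ (U-* (- 1#) v∈)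

    -- Subtracting τ₀(y) times the combination for c from the one for c y kills the τ₀ term.
    combinationsIn-U-twist : ∀ {r} (τ : Fin (suc r) → Carrier → Carrier) → (∀ j → IsAutomorphism K (τ j)) →
      ∀ y (u : Fin (suc r) → Vector D) → CombinationsIn-U τ u →
      CombinationsIn-U (τ ∘ Fin.suc) (λ j x → (τ (Fin.suc j) y - τ Fin.zero y) * u (Fin.suc j) x)
    combinationsIn-U-twist τ τ-aut y u all c = U-resp twisted (U-⊖ (all (c * y)) (U-* (τ Fin.zero y) (all c)))
      where
        d : Fin _ → Carrier
        d j = τ j y - τ Fin.zero y

        coefficient : ∀ j → τ j (c * y) - τ Fin.zero y * τ j c ≈ τ j c * d j
        coefficient j = begin
          τ j (c * y) - τ Fin.zero y * τ j c     ≈⟨ +-cong (IsAutomorphism.σ-* (τ-aut j) c y) (-‿cong (*-comm _ _)) ⟩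
          τ j c * τ j y - τ j c * τ Fin.zero y   ≈⟨ x[y-z]≈xy-xz _ _ _ ⟨
          τ j c * d j                            ∎

        twisted : lin (λ j → τ j (c * y)) u ⊖ τ Fin.zero y · lin (λ j → τ j c) u
                  ≈ᵛ lin (λ j → τ (Fin.suc j) c) (λ j x → d (Fin.suc j) * u (Fin.suc j) x)
        twisted x = trans (+-congˡ (*-congˡ (sym (lin-*ᶜ (τ Fin.zero y) (λ j → τ j c) u x))))
          (trans (sym (lin--ᶜ (λ j → τ j (c * y)) (λ j → τ Fin.zero y * τ j c) u x))
          (trans (lin-cong {b = u} {b′ = u} coefficient (λ _ _ → refl) x)
          (trans (lin-*· (λ j → τ j c) d u x)
          (trans (+-congʳ (trans (*-congˡ (trans (*-congʳ (-‿inverseʳ (τ Fin.zero y))) (zeroˡ _))) (zeroʳ _))) (+-identityˡ _)))))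

    combinationsIn-U-drop₁ : ∀ {r} (τ : Fin (suc (suc r)) → Carrier → Carrier) (u : Fin (suc (suc r)) → Vector D) →
      CombinationsIn-U τ u → U (u (Fin.suc Fin.zero)) →
      CombinationsIn-U (τ ∘ Fin.punchIn (Fin.suc Fin.zero)) (u ∘ Fin.punchIn (Fin.suc Fin.zero))
    combinationsIn-U-drop₁ τ u all u₁∈ c = U-resp dropped (U-⊖ (all c) (U-* (τ (Fin.suc Fin.zero) c) u₁∈))
      where
        dropped : ∀ x → (lin (λ j → τ j c) u ⊖ (λ i → τ (Fin.suc Fin.zero) c * u (Fin.suc Fin.zero) i)) x
                  ≈ lin (λ j → τ (Fin.punchIn (Fin.suc Fin.zero) j) c) (u ∘ Fin.punchIn (Fin.suc Fin.zero)) x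
        dropped x = begin
          (a + (b + r)) + - 1# * b   ≈⟨ +-congˡ (-1*x≈-x b) ⟩
          (a + (b + r)) - b          ≈⟨ +-congʳ (+-congˡ (+-comm b r)) ⟩
          (a + (r + b)) - b          ≈⟨ +-congʳ (+-assoc a r b) ⟨
          ((a + r) + b) - b          ≈⟨ //-rightDividesʳ b (a + r) ⟩
          a + r                      ∎
          where
            a = τ Fin.zero c * u Fin.zero x
            b = τ (Fin.suc Fin.zero) c * u (Fin.suc Fin.zero) x
            r = lin (λ j → τ (Fin.suc (Fin.suc j)) c) (λ j → u (Fin.suc (Fin.suc j))) x

    DedekindFor : ℕ → Set
    DedekindFor r = ∀ (τ : Fin r → Carrier → Carrier) → (∀ j → IsAutomorphism K (τ j)) → Distinct τ →
                    ∀ u → CombinationsIn-U τ u → ∀ j → U (u j)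

    dedekind-step : ∀ {r} → DedekindFor (suc r) → DedekindFor (suc (suc r))
    dedekind-step dedekind′ τ τ-aut τ-distinct u all = all-in-U
      where
        y = proj₁ (τ-distinct Fin.zero (Fin.suc Fin.zero) (λ ()))
        d₁≉0 : τ (Fin.suc Fin.zero) y - τ Fin.zero y ≉ 0#
        d₁≉0 d₁≈0 = proj₂ (τ-distinct Fin.zero (Fin.suc Fin.zero) (λ ())) (sym (x∙y⁻¹≈ε⇒x≈y _ _ d₁≈0))

        d₁u₁∈ : U (λ x → (τ (Fin.suc Fin.zero) y - τ Fin.zero y) * u (Fin.suc Fin.zero) x)
        d₁u₁∈ = dedekind′ (τ ∘ Fin.suc) (τ-aut ∘ Fin.suc)
                  (λ i j i≢j → τ-distinct (Fin.suc i) (Fin.suc j) (i≢j ∘ Finₚ.suc-injective))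
                  (λ j x → (τ (Fin.suc j) y - τ Fin.zero y) * u (Fin.suc j) x)
                  (combinationsIn-U-twist τ τ-aut y u all) Fin.zero

        u₁∈ : U (u (Fin.suc Fin.zero))
        u₁∈ = U-resp (λ x → trans (sym (*-assoc _ _ _)) (trans (*-congʳ (inv-l _ d₁≉0)) (*-identityˡ _)))
                     (U-* (inv (τ (Fin.suc Fin.zero) y - τ Fin.zero y)) d₁u₁∈)

        without₁ : ∀ j → U (u (Fin.punchIn (Fin.suc Fin.zero) j))
        without₁ = dedekind′ (τ ∘ Fin.punchIn (Fin.suc Fin.zero)) (τ-aut ∘ Fin.punchIn (Fin.suc Fin.zero))
                     (λ i j i≢j → τ-distinct _ _ (i≢j ∘ Finₚ.punchIn-injective (Fin.suc Fin.zero) i j))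
                     (u ∘ Fin.punchIn (Fin.suc Fin.zero)) (combinationsIn-U-drop₁ τ u all u₁∈)

        all-in-U : ∀ j → U (u j)
        all-in-U Fin.zero              = without₁ Fin.zero
        all-in-U (Fin.suc Fin.zero)    = u₁∈
        all-in-U (Fin.suc (Fin.suc j)) = without₁ (Fin.suc j)

    dedekind : ∀ r → DedekindFor r
    dedekind zero          τ τ-aut τ-distinct u all ()
    dedekind (suc zero)    τ τ-aut τ-distinct u all Fin.zero =
      U-resp (λ x → trans (+-identityʳ _) (trans (*-congʳ (IsAutomorphism.σ-1 (τ-aut Fin.zero))) (*-identityˡ _))) (all 1#)
    dedekind (suc (suc r)) = dedekind-step (dedekind (suc r))

module Descent (K : FiniteField) where
  open FieldProperties K
  open SetoidReasoning setoid
  open Automorphisms K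
  open Modules K
  open Dedekind K

  record Semilinear (σ : Carrier → Carrier) (D : ℕ) : Set where
    field
      T      : Vector D → Vector D
      T-cong : ∀ {u v} → u ≈ᵛ v → T u ≈ᵛ T v
      T-+    : ∀ u v → T (λ i → u i + v i) ≈ᵛ (λ i → T u i + T v i)
      T-*    : ∀ a u → T (λ i → a * u i) ≈ᵛ (λ i → σ a * T u i)

  module SemilinearOperator {σ : Carrier → Carrier} (σ-aut : IsAutomorphism K σ) {D : ℕ} (𝕋 : Semilinear σ D) where
    open Semilinear 𝕋
    open Automorphism σ-aut
    open Module (vectorModule D) using (lin; lin-cong; lin--ᶜ; lin-*ᶜ; lin-+ᶜ; sum; sum-cong; sum-rotate; lin≋sum; _⊕_; 𝟘)

    T-𝟘 : T 𝟘 ≈ᵛ 𝟘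
    T-𝟘 x = trans (T-cong (λ i → sym (zeroˡ 0#)) x) (trans (T-* 0# 𝟘 x) (trans (*-congʳ σ-0) (zeroˡ _)))

    T-lin : ∀ {k} c (b : Fin k → Vector D) → T (lin c b) ≈ᵛ lin (λ i → σ (c i)) (λ i → T (b i))
    T-lin = lin-semilinear (vectorModule D) (vectorModule D) σ T T-+ T-* T-𝟘

    T-iterate-cong : ∀ j {u v} → u ≈ᵛ v → iterate T j u ≈ᵛ iterate T j v
    T-iterate-cong zero    u≈v = u≈v
    T-iterate-cong (suc j) u≈v = T-cong (T-iterate-cong j u≈v)

    T-iterate-* : ∀ j a u → iterate T j (λ i → a * u i) ≈ᵛ (λ i → iter K σ j a * iterate T j u i)
    T-iterate-* zero    a u x = refl
    T-iterate-* (suc j) a u x = trans (T-cong (T-iterate-* j a u) x) (T-* (iter K σ j a) (iterate T j u) x)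

    T-sum : ∀ m f → T (sum m f) ≈ᵛ sum m (λ j → T (f j))
    T-sum zero    f = T-𝟘
    T-sum (suc m) f x = trans (T-+ _ _ x) (+-congˡ (T-sum m (λ j → f (suc j)) x))

    T-iterate-𝟘 : ∀ j → iterate T j 𝟘 ≈ᵛ 𝟘
    T-iterate-𝟘 zero    i = refl
    T-iterate-𝟘 (suc j) i = trans (T-cong (T-iterate-𝟘 j) i) (T-𝟘 i)

    T-iterate-+ : ∀ j u v → iterate T j (u ⊕ v) ≈ᵛ iterate T j u ⊕ iterate T j v
    T-iterate-+ zero    u v i = refl
    T-iterate-+ (suc j) u v i = trans (T-cong (T-iterate-+ j u v) i) (T-+ _ _ i)

    module PeriodicVectors (n : ℕ) (σ-period : ∀ x → iter K σ n x ≈ x) where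
      Periodic : Vector D → Set
      Periodic w = iterate T n w ≈ᵛ w

      Periodic-resp : ∀ {u v} → u ≈ᵛ v → Periodic u → Periodic v
      Periodic-resp u≈v per i = trans (sym (T-iterate-cong n u≈v i)) (trans (per i) (u≈v i))

      Periodic-𝟘 : Periodic 𝟘
      Periodic-𝟘 = T-iterate-𝟘 n

      Periodic-+ : ∀ {u v} → Periodic u → Periodic v → Periodic (u ⊕ v)
      Periodic-+ per-u per-v i = trans (T-iterate-+ n _ _ i) (+-cong (per-u i) (per-v i))

      Periodic-* : ∀ a {u} → Periodic u → Periodic (λ i → a * u i)
      Periodic-* a per i = trans (T-iterate-* n a _ i) (*-cong (σ-period a) (per i))

      Periodic-T : ∀ {v} → Periodic v → Periodic (T v)
      Periodic-T {v} per i = trans (reflexive (≡.cong (λ w → w i) (≡.sym (iterate-suc T n v)))) (T-cong per i)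

      T-fixed⇒Periodic : ∀ {v} → T v ≈ᵛ v → Periodic v
      T-fixed⇒Periodic {v} Tv≈v = go n
        where
          go : ∀ j → iterate T j v ≈ᵛ v
          go zero    i = refl
          go (suc j) i = trans (T-cong (go j) i) (Tv≈v i)

    -- Applying T to b₀ + ∑ eᵢ bᵢ₊₁ = 0 gives b₀ + ∑ σ(eᵢ) bᵢ₊₁ = 0; subtracting, independence of the tail forces σ(eᵢ) = eᵢ.
    normalised-relation-fixed : ∀ {k} (b : Fin (suc k) → Vector D) → (∀ i → T (b i) ≈ᵛ b i) →
      Independent (vectorModule D) (λ _ → ⊤) (b ∘ Fin.suc) → ∀ e → lin (1# ∷ e) b ≈ᵛ 𝟘 → ∀ i → Fixed K σ (e i)
    normalised-relation-fixed b Tb≈b tail-independent e relation i =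
      sym (x∙y⁻¹≈ε⇒x≈y _ _ (tail-independent (λ i → e i - σ (e i)) (λ _ → tt) difference≈0 i))
      where
        relationσ : lin (1# ∷ (σ ∘ e)) b ≈ᵛ 𝟘
        relationσ x = begin
          1# * b Fin.zero x + lin (σ ∘ e) (b ∘ Fin.suc) x
            ≈⟨ +-cong (*-cong (sym σ-1) (sym (Tb≈b Fin.zero x))) (lin-cong (λ _ → refl) (λ i → sym ∘ Tb≈b (Fin.suc i)) x) ⟩
          σ 1# * T (b Fin.zero) x + lin (σ ∘ e) (T ∘ b ∘ Fin.suc) x
            ≈⟨ +-cong (sym (T-* 1# (b Fin.zero) x)) (sym (T-lin e (b ∘ Fin.suc) x)) ⟩
          T (λ y → 1# * b Fin.zero y) x + T (lin e (b ∘ Fin.suc)) x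
            ≈⟨ T-+ _ _ x ⟨
          T (lin (1# ∷ e) b) x
            ≈⟨ T-cong relation x ⟩
          T 𝟘 x
            ≈⟨ T-𝟘 x ⟩
          0# ∎

        difference≈0 : lin (λ i → e i - σ (e i)) (b ∘ Fin.suc) ≈ᵛ 𝟘
        difference≈0 x = trans (lin--ᶜ e (σ ∘ e) (b ∘ Fin.suc) x) (trans (+-congˡ (-1*x≈-x _))
          (x≈y⇒x∙y⁻¹≈ε (trans (+-inverseʳ-unique _ _ (relation x)) (sym (+-inverseʳ-unique _ _ (relationσ x))))))

    Fixed-independent⇒independent : ∀ {k} (b : Fin k → Vector D) → (∀ i → T (b i) ≈ᵛ b i) →
      Independent (vectorModule D) (Fixed K σ) b → Independent (vectorModule D) (λ _ → ⊤) b
    Fixed-independent⇒independent {zero}  b Tb≈b ind c _ lin≈0 ()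
    Fixed-independent⇒independent {suc k} b Tb≈b ind c _ lin≈0 = by-c₀ (c Fin.zero ≟ 0#)
      where
        tail-independent : Independent (vectorModule D) (λ _ → ⊤) (b ∘ Fin.suc)
        tail-independent = Fixed-independent⇒independent (b ∘ Fin.suc) (Tb≈b ∘ Fin.suc)
          (λ c c∈ lin≈0 i → ind (0# ∷ c) (λ { Fin.zero → σ-0 ; (Fin.suc j) → c∈ j })
            (λ x → trans (+-congʳ (zeroˡ _)) (trans (+-identityˡ _) (lin≈0 x))) (Fin.suc i))

        e : Fin k → Carrier
        e i = inv (c Fin.zero) * c (Fin.suc i)

        normalised : c Fin.zero ≉ 0# → lin (1# ∷ e) b ≈ᵛ 𝟘
        normalised c₀≉0 x = trans (+-congʳ (trans (*-congʳ (sym (inv-l _ c₀≉0))) (*-assoc _ _ _)))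
          (trans (+-congˡ (lin-*ᶜ (inv (c Fin.zero)) (c ∘ Fin.suc) (b ∘ Fin.suc) x))
          (trans (sym (distribˡ _ _ _)) (trans (*-congˡ (lin≈0 x)) (zeroʳ _))))

        by-c₀ : Dec (c Fin.zero ≈ 0#) → ∀ i → c i ≈ 0#
        by-c₀ (yes c₀≈0) Fin.zero    = c₀≈0
        by-c₀ (yes c₀≈0) (Fin.suc i) = tail-independent (c ∘ Fin.suc) (λ _ → tt)
          (λ x → trans (sym (+-identityˡ _)) (trans (+-congʳ (sym (trans (*-congʳ c₀≈0) (zeroˡ _)))) (lin≈0 x))) i
        by-c₀ (no c₀≉0) = ⊥-elim (1≉0 (ind (1# ∷ e)
          (λ { Fin.zero → σ-1 ; (Fin.suc i) → normalised-relation-fixed b Tb≈b tail-independent e (normalised c₀≉0) i })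
          (normalised c₀≉0) Fin.zero))

    module GaloisDescent (m : ℕ) (σ-distinct : Distinct (λ (j : Fin (suc m)) → iter K σ (toℕ j)))
             (E : Vector D → Set) (E-resp : ∀ {u v} → u ≈ᵛ v → E u → E v) (E-𝟘 : E 𝟘)
             (E-+ : ∀ {u v} → E u → E v → E (u ⊕ v)) (E-* : ∀ a {u} → E u → E (λ i → a * u i))
             (E-T : ∀ {v} → E v → E (T v)) (E-period : ∀ {v} → E v → iterate T (suc m) v ≈ᵛ v) where

      Invariant : Vector D → Set
      Invariant v = E v × T v ≈ᵛ v

      E-iterate : ∀ j {v} → E v → E (iterate T j v)
      E-iterate zero    v∈ = v∈
      E-iterate (suc j) v∈ = E-T (E-iterate j v∈)

      E-sum : ∀ n f → (∀ j → E (f j)) → E (sum n f)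
      E-sum zero    f f∈ = E-𝟘
      E-sum (suc n) f f∈ = E-+ (f∈ 0) (E-sum n (λ j → f (suc j)) (λ j → f∈ (suc j)))

      trace : Vector D → Vector D
      trace v = sum (suc m) (λ j → iterate T j v)

      trace-Invariant : ∀ {v} → E v → Invariant (trace v)
      trace-Invariant {v} v∈ = E-sum (suc m) _ (λ j → E-iterate j v∈)
        , λ x → trans (T-sum (suc m) (λ j → iterate T j v) x)
                      (sum-rotate (suc m) (λ j → iterate T j v) (E-period v∈) x)

      module _ {k} (b : Fin k → Vector D) (b-spans : _Spans_ (vectorModule D) (Fixed K σ) b Invariant) where
        InSpan : Vector D → Set
        InSpan v = ∃ λ c → v ≈ᵛ lin c b

        InSpan-resp : ∀ {u v} → u ≈ᵛ v → InSpan u → InSpan v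
        InSpan-resp u≈v (c , u≈) = c , λ x → trans (sym (u≈v x)) (u≈ x)

        InSpan-+ : ∀ {u v} → InSpan u → InSpan v → InSpan (λ i → u i + v i)
        InSpan-+ (c , u≈) (c′ , v≈) = (λ i → c i + c′ i) , λ x → trans (+-cong (u≈ x) (v≈ x)) (sym (lin-+ᶜ c c′ b x))

        InSpan-* : ∀ a {u} → InSpan u → InSpan (λ i → a * u i)
        InSpan-* a (c , u≈) = (λ i → a * c i) , λ x → trans (*-congˡ (u≈ x)) (sym (lin-*ᶜ a c b x))

        -- The trace of c e is the σ-twisted combination ∑ σʲ(c) Tʲ(e), so Dedekind's lemma applies.
        spans-E : _Spans_ (vectorModule D) (λ _ → ⊤) b E
        spans-E e e∈ =
          let (c , e≈) = dedekind InSpan InSpan-resp InSpan-+ InSpan-* (suc m) (λ j → iter K σ (toℕ j))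
                           (λ j → iter-isAutomorphism σ-aut (toℕ j)) σ-distinct (λ j → iterate T (toℕ j) e)
                           traces-InSpan Fin.zero
          in c , (λ _ → tt) , e≈
          where
            traces-InSpan : ∀ c → InSpan (lin {suc m} (λ j → iter K σ (toℕ j) c) (λ j → iterate T (toℕ j) e))
            traces-InSpan c =
              let (c′ , _ , t≈) = b-spans (trace (λ i → c * e i)) (trace-Invariant (E-* c e∈)) in
              InSpan-resp (λ x → sym (trans (lin≋sum (suc m) (λ j → iter K σ j c) (λ j → iterate T j e) x)
                                            (sum-cong (suc m) (λ j → λ y → sym (T-iterate-* j c e y)) x)))
                          (c′ , t≈)

      descent : ∀ {k} → Basis (vectorModule D) (Fixed K σ) Invariant k → Basis (vectorModule D) (λ _ → ⊤) E k
      descent B = record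
        { vec = vec ; vec∈W = proj₁ ∘ vec∈W
        ; independent = Fixed-independent⇒independent vec (proj₂ ∘ vec∈W) independent
        ; spanning = spans-E vec spanning }
        where open Basis B

module Periods (K : FiniteField) {σ : FiniteField.Carrier K → FiniteField.Carrier K} (σ-aut : IsAutomorphism K σ) where
  open FieldProperties K
  open SetoidReasoning setoid
  open Automorphisms K
  open Dedekind K using (Distinct)
  private module σ^ (j : ℕ) = IsAutomorphism (iter-isAutomorphism σ-aut j)

  Period : ℕ → Set
  Period j = ∀ x → iter K σ j x ≈ x

  private
    enumerated-Period? : ∀ j → Dec (∀ i → iter K σ j (enum i) ≈ enum i)
    enumerated-Period? j = Finₚ.all? (λ i → iter K σ j (enum i) ≟ enum i)

    enumerated⇒Period : ∀ {j} → (∀ i → iter K σ j (enum i) ≈ enum i) → Period j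
    enumerated⇒Period {j} fixes x = let (i , eᵢ≈x) = enum-surj x in
      trans (σ^.σ-cong j (sym eᵢ≈x)) (trans (fixes i) eᵢ≈x)

  Period? : ∀ j → Dec (Period j)
  Period? j with enumerated-Period? j
  ... | yes fixes = yes (enumerated⇒Period {j} fixes)
  ... | no ¬fixes = no λ per → ¬fixes (per ∘ enum)

  ¬Period⇒moved : ∀ j → ¬ Period j → ∃ λ y → iter K σ j y ≉ y
  ¬Period⇒moved j ¬per with enumerated-Period? j
  ... | yes fixes = ⊥-elim (¬per (enumerated⇒Period {j} fixes))
  ... | no ¬fixes = let (i , moved) = Finₚ.¬∀⟶∃¬ size _ (λ i → iter K σ j (enum i) ≟ enum i) ¬fixes in enum i , moved

  iter-cancelˡ : ∀ a d y → iter K σ a y ≈ iter K σ (a ℕ.+ d) y → iter K σ d y ≈ y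
  iter-cancelˡ a d y e = sym (σ^.σ-inj a y (iter K σ d y) (trans e (reflexive (iter-+ σ a d y))))

  iter-*-period : ∀ p x → iter K σ p x ≈ x → ∀ t → iter K σ (t ℕ.* p) x ≈ x
  iter-*-period p x per zero    = refl
  iter-*-period p x per (suc t) = trans (reflexive (iter-+ σ p (t ℕ.* p) x)) (trans (σ^.σ-cong p (iter-*-period p x per t)) per)

  orbit-returns : ∀ x → ∃ λ p → 1 ≤ p × p ≤ size × iter K σ p x ≈ x
  orbit-returns x with Finₚ.pigeonhole (ℕₚ.n<1+n size) (λ i → proj₁ (enum-surj (iter K σ (toℕ i) x)))
  ... | i , j , i<j , same-index = toℕ j ∸ toℕ i , ℕₚ.m<n⇒0<n∸m i<j
      , ℕₚ.≤-trans (ℕₚ.m∸n≤m (toℕ j) (toℕ i)) (ℕₚ.≤-pred (Finₚ.toℕ<n j))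
      , iter-cancelˡ (toℕ i) (toℕ j ∸ toℕ i) x (begin
          iter K σ (toℕ i) x                       ≈⟨ proj₂ (enum-surj _) ⟨
          enum (proj₁ (enum-surj _))               ≡⟨ ≡.cong enum same-index ⟩
          enum (proj₁ (enum-surj _))               ≈⟨ proj₂ (enum-surj _) ⟩
          iter K σ (toℕ j) x                       ≡⟨ ≡.cong (λ t → iter K σ t x) (ℕₚ.m+[n∸m]≡n (ℕₚ.<⇒≤ i<j)) ⟨
          iter K σ (toℕ i ℕ.+ (toℕ j ∸ toℕ i)) x   ∎)

  Period-size! : Period (size !)
  Period-size! x with orbit-returns x
  ... | suc p , _ , p≤size , per with ∣-trans (m∣m*n {suc p} (p !)) (m≤n⇒m!∣n! p≤size)
  ... | divides t size!≡t*p = trans (reflexive (≡.cong (λ z → iter K σ z x) size!≡t*p)) (iter-*-period (suc p) x per t)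

  minimal-period : ∃ λ m → Period (suc m) × (∀ j → j < m → ¬ Period (suc j))
  minimal-period with Finₚ.¬∀⟶∃¬-smallest (size !) (λ i → ¬ Period (suc (toℕ i))) (λ i → ¬? (Period? (suc (toℕ i)))) ¬all-aperiodic
    where
      ¬all-aperiodic : ¬ (∀ (i : Fin (size !)) → ¬ Period (suc (toℕ i)))
      ¬all-aperiodic aperiodic with size ! | ℕₚ.1≤n! size | Period-size!
      ... | suc N | _ | per = aperiodic (fromℕ N) (≡.subst (λ t → Period (suc t)) (≡.sym (Finₚ.toℕ-fromℕ N)) per)
  ... | i , ¬¬per , below = toℕ i , decidable-stable (Period? (suc (toℕ i))) ¬¬per
      , λ j j<i → ≡.subst (λ t → ¬ Period (suc t)) (≡.trans (Finₚ.toℕ-inject (Fin.fromℕ< j<i)) (Finₚ.toℕ-fromℕ< j<i))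
                          (below (Fin.fromℕ< j<i))

  module _ (m : ℕ) (aperiodic : ∀ j → j < m → ¬ Period (suc j)) where
    private
      distinct< : ∀ {a b : Fin (suc m)} → toℕ a < toℕ b → ∃ λ y → iter K σ (toℕ a) y ≉ iter K σ (toℕ b) y
      distinct< {a} {b} a<b = y , λ e → moved (iter-cancelˡ (toℕ a) (suc d) y (trans e (reflexive (≡.cong (λ t → iter K σ t y) b≡a+1+d))))
        where
          d = toℕ b ∸ suc (toℕ a)
          d+1+a≡b : d ℕ.+ suc (toℕ a) ≡ toℕ b
          d+1+a≡b = ℕₚ.m∸n+n≡m a<b
          b≡a+1+d : toℕ b ≡ toℕ a ℕ.+ suc d
          b≡a+1+d = ≡.trans (≡.sym d+1+a≡b) (≡.trans (ℕₚ.+-comm d (suc (toℕ a))) (≡.sym (ℕₚ.+-suc (toℕ a) d)))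
          d<m : d < m
          d<m = ℕₚ.≤-trans (s≤s (ℕₚ.m≤m+n d (toℕ a)))
                  (ℕₚ.≤-trans (ℕₚ.≤-reflexive (≡.trans (≡.sym (ℕₚ.+-suc d (toℕ a))) d+1+a≡b)) (ℕₚ.≤-pred (Finₚ.toℕ<n b)))
          y = proj₁ (¬Period⇒moved (suc d) (aperiodic d d<m))
          moved = proj₂ (¬Period⇒moved (suc d) (aperiodic d d<m))

    powers-distinct : Distinct (λ (i : Fin (suc m)) → iter K σ (toℕ i))
    powers-distinct i j i≢j with ℕₚ.<-cmp (toℕ i) (toℕ j)
    ... | tri< i<j _ _ = distinct< i<j
    ... | tri≈ _ i≡j _ = ⊥-elim (i≢j (Finₚ.toℕ-injective i≡j))
    ... | tri> _ _ j<i = let (y , moved) = distinct< j<i in y , moved ∘ sym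

module FixedField (K : FiniteField) {σ : FiniteField.Carrier K → FiniteField.Carrier K} (σ-aut : IsAutomorphism K σ)
                  {q : ℕ} (fixed-card : HasCard K (Fixed K σ) q) where
  open FieldProperties K
  open Automorphisms K
  open Automorphism σ-aut
  open Counting K
  open Bases K

  fixedField : Enumerated
  fixedField = record
    { Member = Fixed K σ ; count = q ; card = fixed-card }

  fixedField-isSubfield : IsSubfield fixedField
  fixedField-isSubfield = record
    { 0∈ = σ-0 ; 1∈ = σ-1
    ; +-∈ = λ σx≈x σy≈y → trans (σ-+ _ _) (+-cong σx≈x σy≈y)
    ; *-∈ = λ σx≈x σy≈y → trans (σ-* _ _) (*-cong σx≈x σy≈y)
    ; -‿∈ = λ σx≈x → trans (σ-‿ _) (-‿cong σx≈x)
    ; inv-∈ = λ {x} x≉0 σx≈x → trans (σ-inv x≉0) (inv-cong (σ-≉0 x≉0) σx≈x) }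

module Artin (K : FiniteField) {σ : FiniteField.Carrier K → FiniteField.Carrier K} (σ-aut : IsAutomorphism K σ)
             {q n : ℕ} (size≡q^n : FiniteField.size K ≡ q ^ n) (fixed-card : HasCard K (Fixed K σ) q) where
  open FieldProperties K
  open Automorphisms K
  open Automorphism σ-aut
  open Modules K
  open Counting K
  open Bases K
  open Descent K
  open Periods K σ-aut
  open FixedField K σ-aut fixed-card
  open Dedekind K using (Distinct)
  private module σ^ (j : ℕ) = IsAutomorphism (iter-isAutomorphism σ-aut j)

  module _ (m : ℕ) (period : Period (suc m)) (aperiodic : ∀ j → j < m → ¬ Period (suc j)) where
    prev : Fin (suc m) → Fin (suc m)
    prev Fin.zero    = fromℕ m
    prev (Fin.suc i) = inject₁ i

    prev-iterate-toℕ : ∀ t (i : Fin (suc m)) → t ≤ toℕ i → toℕ (iterate prev t i) ≡ toℕ i ∸ t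
    prev-iterate-toℕ zero    i           _         = ≡.refl
    prev-iterate-toℕ (suc t) (Fin.suc i) (s≤s t≤i) = ≡.trans (≡.cong toℕ (iterate-suc prev t (Fin.suc i)))
      (≡.trans (prev-iterate-toℕ t (inject₁ i) (≡.subst (t ≤_) (≡.sym (Finₚ.toℕ-inject₁ i)) t≤i))
               (≡.cong (_∸ t) (Finₚ.toℕ-inject₁ i)))

    prev-period : ∀ i → iterate prev (suc m) i ≡ i
    prev-period i = Finₚ.toℕ-injective (begin
      toℕ (iterate prev (suc m) i)                          ≡⟨ ≡.cong (λ t → toℕ (iterate prev t i)) 1+m≡ ⟩
      toℕ (iterate prev (m ∸ toℕ i ℕ.+ suc (toℕ i)) i)       ≡⟨ ≡.cong toℕ (iterate-+ prev (m ∸ toℕ i) (suc (toℕ i)) i) ⟩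
      toℕ (iterate prev (m ∸ toℕ i) (iterate prev (suc (toℕ i)) i)) ≡⟨ ≡.cong (λ j → toℕ (iterate prev (m ∸ toℕ i) j)) reaches-last ⟩
      toℕ (iterate prev (m ∸ toℕ i) (fromℕ m))               ≡⟨ prev-iterate-toℕ (m ∸ toℕ i) (fromℕ m) m∸i≤m ⟩
      toℕ (fromℕ m) ∸ (m ∸ toℕ i)                            ≡⟨ ≡.cong (_∸ (m ∸ toℕ i)) (Finₚ.toℕ-fromℕ m) ⟩
      m ∸ (m ∸ toℕ i)                                        ≡⟨ ℕₚ.m∸[m∸n]≡n i≤m ⟩
      toℕ i                                                  ∎)
      where
        open ≡.≡-Reasoning
        i≤m : toℕ i ≤ m
        i≤m = ℕₚ.≤-pred (Finₚ.toℕ<n i)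
        1+m≡ : suc m ≡ m ∸ toℕ i ℕ.+ suc (toℕ i)
        1+m≡ = ≡.sym (≡.trans (ℕₚ.+-suc (m ∸ toℕ i) (toℕ i)) (≡.cong suc (ℕₚ.m∸n+n≡m i≤m)))
        m∸i≤m : m ∸ toℕ i ≤ toℕ (fromℕ m)
        m∸i≤m = ≡.subst (m ∸ toℕ i ≤_) (≡.sym (Finₚ.toℕ-fromℕ m)) (ℕₚ.m∸n≤m m (toℕ i))
        reaches-last : iterate prev (suc (toℕ i)) i ≡ fromℕ m
        reaches-last = ≡.cong prev (Finₚ.toℕ-injective {j = Fin.zero}
          (≡.trans (prev-iterate-toℕ (toℕ i) i ℕₚ.≤-refl) (ℕₚ.n∸n≡0 (toℕ i))))

    shift : Semilinear σ (suc m)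
    shift = record
      { T = λ v i → σ (v (prev i)) ; T-cong = λ u≈v i → σ-cong (u≈v (prev i))
      ; T-+ = λ u v i → σ-+ _ _ ; T-* = λ a u i → σ-* _ _ }

    open Semilinear shift

    T-iterate : ∀ j v i → iterate T j v i ≈ iter K σ j (v (iterate prev j i))
    T-iterate zero    v i = refl
    T-iterate (suc j) v i = σ-cong (trans (T-iterate j v (prev i))
                                          (reflexive (≡.cong (iter K σ j ∘ v) (≡.sym (iterate-suc prev j i)))))

    T-period : ∀ v → iterate T (suc m) v ≈ᵛ v
    T-period v i = trans (T-iterate (suc m) v i)
                         (trans (reflexive (≡.cong (iter K σ (suc m) ∘ v) (prev-period i))) (period (v i)))

    orbit : Carrier → Vector (suc m)
    orbit x i = iter K σ (toℕ i) x

    T-orbit : ∀ x → T (orbit x) ≈ᵛ orbit x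
    T-orbit x Fin.zero    = trans (σ-cong (reflexive (≡.cong (λ t → iter K σ t x) (Finₚ.toℕ-fromℕ m)))) (period x)
    T-orbit x (Fin.suc i) = σ-cong (reflexive (≡.cong (λ t → iter K σ t x) (Finₚ.toℕ-inject₁ i)))

    T-fixed⇒orbit : ∀ v → T v ≈ᵛ v → v ≈ᵛ orbit (v Fin.zero)
    T-fixed⇒orbit v Tv≈v i = go (toℕ i) i ≡.refl
      where
        go : ∀ t (i : Fin (suc m)) → toℕ i ≡ t → v i ≈ iter K σ t (v Fin.zero)
        go zero    Fin.zero    _   = refl
        go (suc t) (Fin.suc i) i≡t = trans (sym (Tv≈v (Fin.suc i)))
          (σ-cong (go t (inject₁ i) (≡.trans (Finₚ.toℕ-inject₁ i) (ℕₚ.suc-injective i≡t))))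

    open SemilinearOperator σ-aut shift using (T-lin)
    open SemilinearOperator.GaloisDescent σ-aut shift m (powers-distinct m aperiodic)
      (λ _ → ⊤) (λ _ _ → tt) tt (λ _ _ → tt) (λ _ _ → tt) (λ _ → tt) (λ {v} _ → T-period v)
      using (Invariant; descent)

    Invariant? : ∀ v → Dec (Invariant v)
    Invariant? v with T v ≟ᵛ v
    ... | yes Tv≈v = yes (tt , Tv≈v)
    ... | no ¬Tv≈v = no (¬Tv≈v ∘ proj₂)

    Invariant-resp : ∀ {u v} → u ≈ᵛ v → Invariant u → Invariant v
    Invariant-resp u≈v (_ , Tu≈u) = tt , λ i → trans (sym (T-cong u≈v i)) (trans (Tu≈u i) (u≈v i))

    #Invariant≡size : ∑ᴷ (suc m) (λ v → 𝟙 (Invariant? v)) ≡ size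
    #Invariant≡size = ≡.trans
      (∑ᴷ-𝟙-image allOfK {1} (λ c → orbit (c Fin.zero)) (λ c≈c′ i → σ^.σ-cong (toℕ i) (c≈c′ Fin.zero))
        (λ _ _ e → λ { Fin.zero → e Fin.zero ; (Fin.suc ()) }) Invariant Invariant?
        (λ v (_ , Tv≈v) → (λ _ → v Fin.zero) , (λ _ → tt) , λ i → sym (T-fixed⇒orbit v Tv≈v i))
        (λ v (c , _ , orbit≈v) → Invariant-resp orbit≈v (tt , T-orbit (c Fin.zero))))
      (ℕₚ.*-identityʳ size)

    -- The invariant vectors are the orbits (σⁱ x)ᵢ, so a σ-fixed basis of them has q ^ k = size; by descent it is
    -- also a K-basis of K^(1+m), so k = 1 + m.
    order≡n : suc m ≡ n
    order≡n = ^-injectiveʳ q (2≤count fixedField fixedField-isSubfield) {suc m} {n} (≡.trans q^m≡q^k (≡.trans q^k≡size size≡q^n))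
      where
        fixedBasis = basis-exists fixedField fixedField-isSubfield Invariant Invariant? Invariant-resp
        k = proj₁ fixedBasis
        B = proj₂ fixedBasis
        open Module (vectorModule (suc m)) using (lin; lin-cong)

        q^k≡size : q ^ k ≡ size
        q^k≡size = ≡.trans (≡.sym (∑ᴷ-𝟙-basis fixedField fixedField-isSubfield Invariant Invariant? Invariant-resp B
          (λ c c∈ → tt , λ x → trans (T-lin c (Basis.vec B) x) (lin-cong c∈ (λ i → proj₂ (Basis.vec∈W B i)) x))))
          #Invariant≡size

        size^k≡size^m : size ^ k ≡ size ^ suc m
        size^k≡size^m = ≡.trans (≡.sym (∑ᴷ-𝟙-basis allOfK allOfK-isSubfield (λ _ → ⊤) (λ _ → yes tt) (λ _ _ → tt) (descent B) (λ _ _ → tt)))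
                                (≡.trans (∑ᴷ-const (suc m) 1) (ℕₚ.*-identityʳ _))

        q^m≡q^k : q ^ suc m ≡ q ^ k
        q^m≡q^k = ≡.cong (q ^_) (≡.sym (^-injectiveʳ size (2≤count allOfK allOfK-isSubfield) {k} {suc m} size^k≡size^m))

  record Order : Set where
    field
      n′       : ℕ
      n≡1+n′   : n ≡ suc n′
      period   : Period n
      distinct : Distinct (λ (j : Fin (suc n′)) → iter K σ (toℕ j))

  σ-order : Order
  σ-order = record
    { n′ = m ; n≡1+n′ = ≡.sym m≡n ; period = ≡.subst Period m≡n period
    ; distinct = powers-distinct m aperiodic }
    where
      m = proj₁ minimal-period
      period = proj₁ (proj₂ minimal-period)
      aperiodic = proj₂ (proj₂ minimal-period)
      m≡n = order≡n m period aperiodic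

module Matrices (K : FiniteField) where
  open FieldProperties K
  open SetoidReasoning setoid
  open Modules K using (Vector; _≈ᵛ_)

  if-≡ : ∀ {a b} {x y : Carrier} → a ≡ b → (if does (a ℕ.≟ b) then x else y) ≡ x
  if-≡ {a} {b} {x} {y} a≡b = ≡.cong (if_then x else y) (dec-true (a ℕ.≟ b) a≡b)

  if-≢ : ∀ {a b} {x y : Carrier} → a ≢ b → (if does (a ℕ.≟ b) then x else y) ≡ y
  if-≢ {a} {b} {x} {y} a≢b = ≡.cong (if_then x else y) (dec-false (a ℕ.≟ b) a≢b)

  δ : ℕ → ℕ → Carrier
  δ a b = if does (a ℕ.≟ b) then 1# else 0#

  automorphism-δ : ∀ {τ} → IsAutomorphism K τ → ∀ a b → τ (δ a b) ≈ δ a b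
  automorphism-δ τ-aut a b with a ℕ.≟ b
  ... | yes a≡b = trans (σ-cong (reflexive (if-≡ a≡b))) (trans σ-1 (reflexive (≡.sym (if-≡ a≡b))))
    where open IsAutomorphism τ-aut
  ... | no a≢b  = trans (σ-cong (reflexive (if-≢ a≢b))) (trans σ-0 (reflexive (≡.sym (if-≢ a≢b))))
    where open Automorphisms.Automorphism K τ-aut

  ∑-cong : ∀ {k} {f g : Fin k → Carrier} → (∀ i → f i ≈ g i) → ∑ K f ≈ ∑ K g
  ∑-cong {zero}  f≈g = refl
  ∑-cong {suc k} f≈g = +-cong (f≈g Fin.zero) (∑-cong (f≈g ∘ Fin.suc))

  ∑-distrib-+ : ∀ {k} (f g : Fin k → Carrier) → ∑ K (λ i → f i + g i) ≈ ∑ K f + ∑ K g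
  ∑-distrib-+ {zero}  f g = sym (+-identityˡ 0#)
  ∑-distrib-+ {suc k} f g = trans (+-congˡ (∑-distrib-+ (f ∘ Fin.suc) (g ∘ Fin.suc))) (+-interchange _ _ _ _)

  ∑-*ˡ : ∀ {k} c (f : Fin k → Carrier) → ∑ K (λ i → c * f i) ≈ c * ∑ K f
  ∑-*ˡ {zero}  c f = sym (zeroʳ c)
  ∑-*ˡ {suc k} c f = trans (+-congˡ (∑-*ˡ c (f ∘ Fin.suc))) (sym (distribˡ _ _ _))

  ∑-*ʳ : ∀ {k} c (f : Fin k → Carrier) → ∑ K (λ i → f i * c) ≈ ∑ K f * c
  ∑-*ʳ c f = trans (∑-cong (λ i → *-comm (f i) c)) (trans (∑-*ˡ c f) (*-comm _ _))

  ∑-0 : ∀ {k} (f : Fin k → Carrier) → (∀ i → f i ≈ 0#) → ∑ K f ≈ 0#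
  ∑-0 {zero}  f f≈0 = refl
  ∑-0 {suc k} f f≈0 = trans (+-cong (f≈0 Fin.zero) (∑-0 (f ∘ Fin.suc) (f≈0 ∘ Fin.suc))) (+-identityˡ 0#)

  ∑-‿ : ∀ {k} (f : Fin k → Carrier) → ∑ K (λ i → - f i) ≈ - ∑ K f
  ∑-‿ f = trans (∑-cong (λ i → sym (-1*x≈-x (f i)))) (trans (∑-*ˡ (- 1#) f) (-1*x≈-x _))

  ∑-comm : ∀ {k l} (f : Fin k → Fin l → Carrier) → ∑ K (λ i → ∑ K (f i)) ≈ ∑ K (λ j → ∑ K (λ i → f i j))
  ∑-comm {zero}  {l} f = sym (∑-0 {l} (λ _ → 0#) (λ _ → refl))
  ∑-comm {suc k} {l} f = trans (+-congˡ (∑-comm (f ∘ Fin.suc))) (sym (∑-distrib-+ (f Fin.zero) (λ j → ∑ K (λ i → f (Fin.suc i) j))))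

  ∑-init-last : ∀ {k} (f : Fin (suc k) → Carrier) → ∑ K f ≈ ∑ K (f ∘ inject₁) + f (fromℕ k)
  ∑-init-last {zero}  f = trans (+-identityʳ _) (sym (+-identityˡ _))
  ∑-init-last {suc k} f = trans (+-congˡ (∑-init-last (f ∘ Fin.suc))) (sym (+-assoc _ _ _))

  automorphism-∑ : ∀ {τ} → IsAutomorphism K τ → ∀ {k} (f : Fin k → Carrier) → τ (∑ K f) ≈ ∑ K (τ ∘ f)
  automorphism-∑ τ-aut {zero}  f = Automorphisms.Automorphism.σ-0 K τ-aut
  automorphism-∑ τ-aut {suc k} f = trans (IsAutomorphism.σ-+ τ-aut _ _) (+-congˡ (automorphism-∑ τ-aut (f ∘ Fin.suc)))

  ∑-δ : ∀ {k} (f : Fin k → Carrier) (i₀ : Fin k) → ∑ K (λ i → f i * δ (toℕ i) (toℕ i₀)) ≈ f i₀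
  ∑-δ {suc k} f Fin.zero = trans (+-cong (*-identityʳ _) (∑-0 (λ i → f (Fin.suc i) * 0#) (λ i → zeroʳ _))) (+-identityʳ _)
  ∑-δ {suc k} f (Fin.suc i₀) = trans (+-cong (zeroʳ _) (∑-δ (f ∘ Fin.suc) i₀)) (+-identityˡ _)

  infixl 7 _·ᴹ_
  _·ᴹ_ : ∀ {d} → Vector d → Matrix K d → Vector d
  (w ·ᴹ M) j = ∑ K (λ i → w i * M i j)

  ·ᴹ-congˡ : ∀ {d} {u v : Vector d} (M : Matrix K d) → u ≈ᵛ v → u ·ᴹ M ≈ᵛ v ·ᴹ M
  ·ᴹ-congˡ M u≈v j = ∑-cong (λ i → *-congʳ (u≈v i))

  ·ᴹ-identityʳ : ∀ {d} (w : Vector d) → w ·ᴹ idMat K ≈ᵛ w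
  ·ᴹ-identityʳ w j = ∑-δ w j

  ·ᴹ-⊗ : ∀ {d} (w : Vector d) (M N : Matrix K d) → w ·ᴹ (_⊗_ K M N) ≈ᵛ (w ·ᴹ M) ·ᴹ N
  ·ᴹ-⊗ w M N j = begin
    ∑ K (λ i → w i * ∑ K (λ k → M i k * N k j))     ≈⟨ ∑-cong (λ i → sym (∑-*ˡ (w i) (λ k → M i k * N k j))) ⟩
    ∑ K (λ i → ∑ K (λ k → w i * (M i k * N k j)))   ≈⟨ ∑-comm (λ i k → w i * (M i k * N k j)) ⟩
    ∑ K (λ k → ∑ K (λ i → w i * (M i k * N k j)))   ≈⟨ ∑-cong (λ k → ∑-cong (λ i → *-assoc (w i) (M i k) (N k j))) ⟨
    ∑ K (λ k → ∑ K (λ i → (w i * M i k) * N k j))   ≈⟨ ∑-cong (λ k → ∑-*ʳ (N k j) (λ i → w i * M i k)) ⟩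
    ∑ K (λ k → (w ·ᴹ M) k * N k j)                  ∎

  *-·ᴹ : ∀ {d} c (u : Vector d) (M : Matrix K d) → (λ i → c * u i) ·ᴹ M ≈ᵛ (λ j → c * (u ·ᴹ M) j)
  *-·ᴹ c u M j = begin
    ∑ K (λ i → (c * u i) * M i j)   ≈⟨ ∑-cong (λ i → *-assoc c (u i) (M i j)) ⟩
    ∑ K (λ i → c * (u i * M i j))   ≈⟨ ∑-*ˡ c (λ i → u i * M i j) ⟩
    c * (u ·ᴹ M) j                  ∎

  -‿·ᴹ : ∀ {d} (u v : Vector d) (M : Matrix K d) → (λ i → u i - v i) ·ᴹ M ≈ᵛ (λ j → (u ·ᴹ M) j - (v ·ᴹ M) j)
  -‿·ᴹ u v M j = begin
    ∑ K (λ i → (u i - v i) * M i j)            ≈⟨ ∑-cong (λ i → trans ([y-z]x≈yx-zx (M i j) (u i) (v i)) (+-congˡ (-‿distribˡ-* (v i) (M i j)))) ⟩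
    ∑ K (λ i → u i * M i j + - v i * M i j)    ≈⟨ ∑-distrib-+ (λ i → u i * M i j) (λ i → - v i * M i j) ⟩
    (u ·ᴹ M) j + ∑ K (λ i → - v i * M i j)     ≈⟨ +-congˡ (∑-cong (λ i → -‿distribˡ-* (v i) (M i j))) ⟨
    (u ·ᴹ M) j + ∑ K (λ i → - (v i * M i j))   ≈⟨ +-congˡ (∑-‿ (λ i → v i * M i j)) ⟩
    (u ·ᴹ M) j - (v ·ᴹ M) j                    ∎

  automorphism-·ᴹ : ∀ {τ} → IsAutomorphism K τ → ∀ {d} (u : Vector d) (M : Matrix K d) →
                    (λ j → τ ((u ·ᴹ M) j)) ≈ᵛ (τ ∘ u) ·ᴹ mapMat K τ M
  automorphism-·ᴹ τ-aut u M j = trans (automorphism-∑ τ-aut (λ i → u i * M i j)) (∑-cong (λ i → IsAutomorphism.σ-* τ-aut (u i) (M i j)))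

  ·ᴹ-shiftMat : ∀ {d} (M : Matrix K d) λ′ (w : Vector d) → w ·ᴹ shiftMat K M λ′ ≈ᵛ (λ j → (w ·ᴹ M) j - λ′ * w j)
  ·ᴹ-shiftMat M λ′ w j = begin
    ∑ K (λ i → w i * (M i j - λ′ * idMat K i j))
      ≈⟨ ∑-cong (λ i → trans (x[y-z]≈xy-xz (w i) (M i j) (λ′ * idMat K i j)) (+-congˡ (-‿cong (x*yz≈y*xz (w i) λ′ (idMat K i j))))) ⟩
    ∑ K (λ i → w i * M i j - λ′ * (w i * idMat K i j))
      ≈⟨ trans (∑-distrib-+ (λ i → w i * M i j) (λ i → - (λ′ * (w i * idMat K i j)))) (+-congˡ (∑-‿ (λ i → λ′ * (w i * idMat K i j)))) ⟩
    (w ·ᴹ M) j - ∑ K (λ i → λ′ * (w i * idMat K i j))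
      ≈⟨ +-congˡ (-‿cong (trans (∑-*ˡ λ′ (λ i → w i * idMat K i j)) (*-congˡ (∑-δ w j)))) ⟩
    (w ·ᴹ M) j - λ′ * w j ∎

  module Companion (d : ℕ) (a : Fin (suc (suc d)) → Carrier) where
    C : Matrix K (suc d)
    C = companion K (suc d) a

    lastColumn : Vector (suc d)
    lastColumn i = - (a (inject₁ i) * inv (a (fromℕ (suc d))))

    C-inject₁ : ∀ i (j : Fin d) → C i (inject₁ j) ≡ δ (toℕ i) (suc (toℕ j))
    C-inject₁ i j = ≡.trans (if-≢ (λ j≡d → ℕₚ.<-irrefl j≡d (≡.subst (ℕ._< d) (≡.sym (Finₚ.toℕ-inject₁ j)) (Finₚ.toℕ<n j))))
                            (≡.cong (λ t → δ (toℕ i) (suc t)) (Finₚ.toℕ-inject₁ j))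

    C-fromℕ : ∀ i → C i (fromℕ d) ≡ lastColumn i
    C-fromℕ i = if-≡ (Finₚ.toℕ-fromℕ d)

    module _ {τ : Carrier → Carrier} (τ-aut : IsAutomorphism K τ) where
      open IsAutomorphism τ-aut

      ·ᴹ-C-inject₁ : ∀ (u : Vector (suc d)) j → (u ·ᴹ mapMat K τ C) (inject₁ j) ≈ u (Fin.suc j)
      ·ᴹ-C-inject₁ u j = trans (∑-cong (λ i → *-congˡ {u i} (trans (σ-cong (reflexive (C-inject₁ i j)))
                                                              (automorphism-δ τ-aut (toℕ i) (suc (toℕ j))))))
                               (∑-δ u (Fin.suc j))

      ·ᴹ-C-fromℕ : ∀ (u : Vector (suc d)) → (u ·ᴹ mapMat K τ C) (fromℕ d) ≈ ∑ K (λ i → u i * τ (lastColumn i))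
      ·ᴹ-C-fromℕ u = ∑-cong (λ i → *-congˡ {u i} (σ-cong (reflexive (C-fromℕ i))))

-- The σ-degree is suc d, so that the companion matrix is (suc d) × (suc d).
module LinearisedPolynomial (K : FiniteField) {σ : FiniteField.Carrier K → FiniteField.Carrier K} (σ-aut : IsAutomorphism K σ)
  (d : ℕ) (a : Fin (suc (suc d)) → FiniteField.Carrier K)
  (a-top≉0 : ¬ FiniteField._≈_ K (a (fromℕ (suc d))) (FiniteField.0# K))
  (a₀≉0 : ¬ FiniteField._≈_ K (a Fin.zero) (FiniteField.0# K))
  (α : FiniteField.Carrier K) where
  open FieldProperties K
  open SetoidReasoning setoid
  open Automorphisms K
  open Automorphism σ-aut
  open Modules K
  open Matrices K
  open Companion d a
  open Descent K
  private module σ^ (j : ℕ) = IsAutomorphism (iter-isAutomorphism σ-aut j)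

  tailSum : Vector (suc d) → Carrier
  tailSum w = ∑ K (λ j → a (Fin.suc j) * (α * σ (w j)))

  -- T w = α σ(w) C⁻¹, solved explicitly using the shape of the companion matrix C.
  T : Vector (suc d) → Vector (suc d)
  T w Fin.zero    = - (inv (a Fin.zero) * tailSum w)
  T w (Fin.suc i) = α * σ (w (inject₁ i))

  T-cong : ∀ {u v} → u ≈ᵛ v → T u ≈ᵛ T v
  T-cong u≈v Fin.zero    = -‿cong (*-congˡ (∑-cong (λ j → *-congˡ {a (Fin.suc j)} (*-congˡ {α} (σ-cong (u≈v j))))))
  T-cong u≈v (Fin.suc i) = *-congˡ (σ-cong (u≈v (inject₁ i)))

  T-+ : ∀ u v → T (λ i → u i + v i) ≈ᵛ (λ i → T u i + T v i)
  T-+ u v Fin.zero = begin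
    - (inv (a Fin.zero) * tailSum (λ i → u i + v i))
      ≈⟨ -‿cong (*-congˡ (∑-cong (λ j → trans (*-congˡ {a (Fin.suc j)} (trans (*-congˡ (σ-+ (u j) (v j))) (distribˡ α _ _)))
                                             (distribˡ (a (Fin.suc j)) (α * σ (u j)) (α * σ (v j)))))) ⟩
    - (inv (a Fin.zero) * ∑ K (λ j → a (Fin.suc j) * (α * σ (u j)) + a (Fin.suc j) * (α * σ (v j))))
      ≈⟨ -‿cong (*-congˡ (∑-distrib-+ (λ j → a (Fin.suc j) * (α * σ (u j))) (λ j → a (Fin.suc j) * (α * σ (v j))))) ⟩
    - (inv (a Fin.zero) * (tailSum u + tailSum v))
      ≈⟨ -‿cong (distribˡ _ _ _) ⟩
    - (inv (a Fin.zero) * tailSum u + inv (a Fin.zero) * tailSum v)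
      ≈⟨ -‿+-comm _ _ ⟨
    T u Fin.zero + T v Fin.zero ∎
  T-+ u v (Fin.suc i) = trans (*-congˡ (σ-+ _ _)) (distribˡ _ _ _)

  T-* : ∀ c u → T (λ i → c * u i) ≈ᵛ (λ i → σ c * T u i)
  T-* c u Fin.zero = begin
    - (inv (a Fin.zero) * tailSum (λ i → c * u i))
      ≈⟨ -‿cong (*-congˡ (∑-cong (λ j → trans (*-congˡ {a (Fin.suc j)} (trans (*-congˡ (σ-* c (u j))) (x*yz≈y*xz α (σ c) (σ (u j)))))
                                                     (x*yz≈y*xz (a (Fin.suc j)) (σ c) (α * σ (u j)))))) ⟩
    - (inv (a Fin.zero) * ∑ K (λ j → σ c * (a (Fin.suc j) * (α * σ (u j)))))
      ≈⟨ -‿cong (*-congˡ (∑-*ˡ (σ c) (λ j → a (Fin.suc j) * (α * σ (u j))))) ⟩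
    - (inv (a Fin.zero) * (σ c * tailSum u))
      ≈⟨ -‿cong (x*yz≈y*xz _ _ _) ⟩
    - (σ c * (inv (a Fin.zero) * tailSum u))
      ≈⟨ -‿distribʳ-* _ _ ⟩
    σ c * T u Fin.zero ∎
  T-* c u (Fin.suc i) = trans (*-congˡ (σ-* _ _)) (x*yz≈y*xz _ _ _)

  𝕋 : Semilinear σ (suc d)
  𝕋 = record { T = T ; T-cong = T-cong ; T-+ = T-+ ; T-* = T-* }

  T·ᴹC : ∀ w → T w ·ᴹ C ≈ᵛ (λ j → α * σ (w j))
  T·ᴹC w j with view j
  ... | ‵inject₁ j′ = ·ᴹ-C-inject₁ (iter-isAutomorphism σ-aut 0) (T w) j′
  ... | ‵fromℕ      = trans (·ᴹ-C-fromℕ (iter-isAutomorphism σ-aut 0) (T w)) (begin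
    T w Fin.zero * lastColumn Fin.zero + ∑ K (λ i → T w (Fin.suc i) * lastColumn (Fin.suc i))
      ≈⟨ +-cong first rest ⟩
    R * ad⁻¹ + - (R′ * ad⁻¹)  ≈⟨ +-congˡ (-‿distribˡ-* _ _) ⟩
    R * ad⁻¹ + - R′ * ad⁻¹    ≈⟨ distribʳ _ _ _ ⟨
    (R - R′) * ad⁻¹           ≈⟨ *-congʳ (trans (+-congʳ (trans (∑-init-last (λ j → a (Fin.suc j) * (α * σ (w j)))) (+-comm _ _)))
                                                (//-rightDividesʳ R′ _)) ⟩
    (a (fromℕ (suc d)) * X) * ad⁻¹   ≈⟨ xy*z≈y*xz _ _ _ ⟩
    X * (a (fromℕ (suc d)) * ad⁻¹)   ≈⟨ *-congˡ (inv-r _ a-top≉0) ⟩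
    X * 1#                           ≈⟨ *-identityʳ X ⟩
    X ∎)
    where
      ad⁻¹ = inv (a (fromℕ (suc d)))
      X  = α * σ (w (fromℕ d))
      R  = tailSum w
      R′ = ∑ K (λ i → a (Fin.suc (inject₁ i)) * (α * σ (w (inject₁ i))))

      first : T w Fin.zero * lastColumn Fin.zero ≈ R * ad⁻¹
      first = begin
        - (inv (a Fin.zero) * R) * - (a Fin.zero * ad⁻¹)   ≈⟨ -‿distribˡ-* _ _ ⟨
        - (inv (a Fin.zero) * R * - (a Fin.zero * ad⁻¹))   ≈⟨ -‿cong (-‿distribʳ-* _ _) ⟨
        - - (inv (a Fin.zero) * R * (a Fin.zero * ad⁻¹))   ≈⟨ -‿involutive _ ⟩
        inv (a Fin.zero) * R * (a Fin.zero * ad⁻¹)         ≈⟨ *-interchange _ _ _ _ ⟩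
        inv (a Fin.zero) * a Fin.zero * (R * ad⁻¹)         ≈⟨ *-congʳ (inv-l _ a₀≉0) ⟩
        1# * (R * ad⁻¹)                                    ≈⟨ *-identityˡ _ ⟩
        R * ad⁻¹ ∎

      rest : ∑ K (λ i → T w (Fin.suc i) * lastColumn (Fin.suc i)) ≈ - (R′ * ad⁻¹)
      rest = begin
        ∑ K (λ i → X′ i * - (a′ i * ad⁻¹))    ≈⟨ ∑-cong (λ i → -‿distribʳ-* (X′ i) (a′ i * ad⁻¹)) ⟨
        ∑ K (λ i → - (X′ i * (a′ i * ad⁻¹)))  ≈⟨ ∑-cong (λ i → -‿cong (x*yz≈yx*z (X′ i) (a′ i) ad⁻¹)) ⟩
        ∑ K (λ i → - (a′ i * X′ i * ad⁻¹))    ≈⟨ ∑-‿ (λ i → a′ i * X′ i * ad⁻¹) ⟩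
        - ∑ K (λ i → a′ i * X′ i * ad⁻¹)      ≈⟨ -‿cong (∑-*ʳ ad⁻¹ (λ i → a′ i * X′ i)) ⟩
        - (R′ * ad⁻¹)                         ∎
        where
          X′ = λ (i : Fin d) → α * σ (w (inject₁ i))
          a′ = λ (i : Fin d) → a (Fin.suc (inject₁ i))

  P : ℕ → Matrix K (suc d)
  P j = twistedProd K σ C j

  T-iterate·ᴹP : ∀ j w → iterate T j w ·ᴹ P j ≈ᵛ (λ i → bracketPow K σ α j * iter K σ j (w i))
  T-iterate·ᴹP zero    w i = trans (·ᴹ-identityʳ w i) (sym (*-identityˡ _))
  T-iterate·ᴹP (suc j) w k = begin
    (iterate T (suc j) w ·ᴹ (_⊗_ K (P j) (mapMat K (iter K σ j) C))) k
      ≈⟨ ·ᴹ-⊗ (iterate T (suc j) w) (P j) (mapMat K (iter K σ j) C) k ⟩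
    ((iterate T (suc j) w ·ᴹ P j) ·ᴹ mapMat K (iter K σ j) C) k
      ≈⟨ ·ᴹ-congˡ (mapMat K (iter K σ j) C) (λ i → trans (reflexive (≡.cong (λ v → (v ·ᴹ P j) i) (iterate-suc T j w)))
                                                              (T-iterate·ᴹP j (T w) i)) k ⟩
    ((λ i → bracketPow K σ α j * iter K σ j (T w i)) ·ᴹ mapMat K (iter K σ j) C) k
      ≈⟨ *-·ᴹ (bracketPow K σ α j) (λ i → iter K σ j (T w i)) (mapMat K (iter K σ j) C) k ⟩
    bracketPow K σ α j * ((iter K σ j ∘ T w) ·ᴹ mapMat K (iter K σ j) C) k
      ≈⟨ *-congˡ (automorphism-·ᴹ (iter-isAutomorphism σ-aut j) (T w) C k) ⟨
    bracketPow K σ α j * iter K σ j ((T w ·ᴹ C) k)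
      ≈⟨ *-congˡ (σ^.σ-cong j (T·ᴹC w k)) ⟩
    bracketPow K σ α j * iter K σ j (α * σ (w k))
      ≈⟨ *-congˡ (σ^.σ-* j α (σ (w k))) ⟩
    bracketPow K σ α j * (iter K σ j α * iter K σ j (σ (w k)))
      ≈⟨ *-assoc _ _ _ ⟨
    bracketPow K σ α (suc j) * iter K σ j (σ (w k))
      ≡⟨ ≡.cong (bracketPow K σ α (suc j) *_) (iter-suc σ j (w k)) ⟨
    bracketPow K σ α (suc j) * iter K σ (suc j) (w k) ∎

  ·ᴹ-C-injective : ∀ j (v : Vector (suc d)) → v ·ᴹ mapMat K (iter K σ j) C ≈ᵛ (λ _ → 0#) → v ≈ᵛ (λ _ → 0#)
  ·ᴹ-C-injective j v v·C≈0 (Fin.suc i) = trans (sym (·ᴹ-C-inject₁ (iter-isAutomorphism σ-aut j) v i)) (v·C≈0 (inject₁ i))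
  ·ᴹ-C-injective j v v·C≈0 Fin.zero    = x*y≈0⇒y≈0 σʲc₀≉0 (trans (*-comm _ _) (begin
    v Fin.zero * iter K σ j (lastColumn Fin.zero)
      ≈⟨ +-identityʳ _ ⟨
    v Fin.zero * iter K σ j (lastColumn Fin.zero) + 0#
      ≈⟨ +-congˡ (∑-0 (λ i → v (Fin.suc i) * iter K σ j (lastColumn (Fin.suc i)))
                      (λ i → trans (*-congʳ (·ᴹ-C-injective j v v·C≈0 (Fin.suc i))) (zeroˡ _))) ⟨
    ∑ K (λ i → v i * iter K σ j (lastColumn i))
      ≈⟨ ·ᴹ-C-fromℕ (iter-isAutomorphism σ-aut j) v ⟨
    (v ·ᴹ mapMat K (iter K σ j) C) (fromℕ d)
      ≈⟨ v·C≈0 (fromℕ d) ⟩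
    0# ∎))
    where
      σʲc₀≉0 : iter K σ j (lastColumn Fin.zero) ≉ 0#
      σʲc₀≉0 = Automorphism.σ-≉0 (iter-isAutomorphism σ-aut j)
        (λ c₀≈0 → *-≉0 a₀≉0 (inv-≉0 a-top≉0) (trans (sym (-‿involutive _)) (trans (-‿cong c₀≈0) -0#≈0#)))

  ·ᴹ-P-injective : ∀ j (u : Vector (suc d)) → u ·ᴹ P j ≈ᵛ (λ _ → 0#) → u ≈ᵛ (λ _ → 0#)
  ·ᴹ-P-injective zero    u u·P≈0 i = trans (sym (·ᴹ-identityʳ u i)) (u·P≈0 i)
  ·ᴹ-P-injective (suc j) u u·P≈0 = ·ᴹ-P-injective j u (·ᴹ-C-injective j (u ·ᴹ P j)
    (λ k → trans (sym (·ᴹ-⊗ u (P j) (mapMat K (iter K σ j) C) k)) (u·P≈0 k)))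

  twist : Carrier → ℕ → Carrier
  twist x t = bracketPow K σ α t * iter K σ t x

  orbit : Carrier → Vector (suc d)
  orbit x i = twist x (toℕ i)

  α*σ-twist : ∀ x t → α * σ (twist x t) ≈ twist x (suc t)
  α*σ-twist x t = begin
    α * σ (bracketPow K σ α t * iter K σ t x)            ≈⟨ *-congˡ (σ-* _ _) ⟩
    α * (σ (bracketPow K σ α t) * σ (iter K σ t x))      ≈⟨ *-assoc _ _ _ ⟨
    (α * σ (bracketPow K σ α t)) * σ (iter K σ t x)      ≈⟨ *-congʳ (α*σ-bracketPow t) ⟩
    bracketPow K σ α (suc t) * iter K σ (suc t) x        ∎
    where
      α*σ-bracketPow : ∀ t → α * σ (bracketPow K σ α t) ≈ bracketPow K σ α (suc t)
      α*σ-bracketPow zero    = trans (*-congˡ σ-1) (trans (*-identityʳ _) (sym (*-identityˡ _)))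
      α*σ-bracketPow (suc t) = begin
        α * σ (bracketPow K σ α t * iter K σ t α)          ≈⟨ *-congˡ (σ-* _ _) ⟩
        α * (σ (bracketPow K σ α t) * σ (iter K σ t α))    ≈⟨ *-assoc _ _ _ ⟨
        (α * σ (bracketPow K σ α t)) * σ (iter K σ t α)    ≈⟨ *-congʳ (α*σ-bracketPow t) ⟩
        bracketPow K σ α (suc (suc t))                      ∎

  T-orbit-suc : ∀ x (i : Fin d) → T (orbit x) (Fin.suc i) ≈ orbit x (Fin.suc i)
  T-orbit-suc x i = trans (α*σ-twist x (toℕ (inject₁ i))) (reflexive (≡.cong (twist x ∘ suc) (Finₚ.toℕ-inject₁ i)))

  tailSum-orbit : ∀ x → tailSum (orbit x) ≈ ∑ K (λ j → a (Fin.suc j) * twist x (suc (toℕ j)))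
  tailSum-orbit x = ∑-cong (λ j → *-congˡ {a (Fin.suc j)} (α*σ-twist x (toℕ j)))

  evalLα-orbit : ∀ x → evalLα K σ (suc d) a α x ≈ a Fin.zero * x + ∑ K (λ j → a (Fin.suc j) * twist x (suc (toℕ j)))
  evalLα-orbit x = +-cong (*-congʳ (*-identityʳ _)) (∑-cong (λ j → *-assoc (a (Fin.suc j)) (bracketPow K σ α (suc (toℕ j))) (iter K σ (suc (toℕ j)) x)))

  evalLα≈0⇒T-fixed : ∀ x → evalLα K σ (suc d) a α x ≈ 0# → T (orbit x) ≈ᵛ orbit x
  evalLα≈0⇒T-fixed x Lx≈0 Fin.zero = begin
    - (inv (a Fin.zero) * tailSum (orbit x))                                 ≈⟨ -‿cong (*-congˡ (tailSum-orbit x)) ⟩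
    - (inv (a Fin.zero) * ∑ K (λ j → a (Fin.suc j) * twist x (suc (toℕ j))))   ≈⟨ c*x+y≈0⇒x≈-[c⁻¹*y] a₀≉0 (trans (sym (evalLα-orbit x)) Lx≈0) ⟨
    x                                                                         ≈⟨ *-identityˡ x ⟨
    orbit x Fin.zero                                                          ∎
  evalLα≈0⇒T-fixed x Lx≈0 (Fin.suc i) = T-orbit-suc x i

  T-fixed⇒evalLα≈0 : ∀ x → T (orbit x) Fin.zero ≈ orbit x Fin.zero → evalLα K σ (suc d) a α x ≈ 0#
  T-fixed⇒evalLα≈0 x fixed = begin
    evalLα K σ (suc d) a α x                   ≈⟨ evalLα-orbit x ⟩
    a Fin.zero * x + R                          ≈⟨ +-congʳ (*-congˡ x≈) ⟩
    a Fin.zero * - (inv (a Fin.zero) * R) + R   ≈⟨ +-congʳ (-‿distribʳ-* _ _) ⟨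
    - (a Fin.zero * (inv (a Fin.zero) * R)) + R ≈⟨ +-congʳ (-‿cong (trans (sym (*-assoc _ _ _)) (trans (*-congʳ (inv-r _ a₀≉0)) (*-identityˡ R)))) ⟩
    - R + R                                     ≈⟨ -‿inverseˡ R ⟩
    0#                                          ∎
    where
      R = ∑ K (λ j → a (Fin.suc j) * twist x (suc (toℕ j)))
      x≈ : x ≈ - (inv (a Fin.zero) * R)
      x≈ = trans (sym (*-identityˡ x)) (trans (sym fixed) (-‿cong (*-congˡ (tailSum-orbit x))))

  T-fixed⇒orbit : ∀ w → T w ≈ᵛ w → w ≈ᵛ orbit (w Fin.zero)
  T-fixed⇒orbit w Tw≈w i = go (toℕ i) i ≡.refl
    where
      go : ∀ t (i : Fin (suc d)) → toℕ i ≡ t → w i ≈ orbit (w Fin.zero) i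
      go zero    Fin.zero    _   = sym (*-identityˡ _)
      go (suc t) (Fin.suc i) i≡t = trans (sym (Tw≈w (Fin.suc i)))
        (trans (*-congˡ (σ-cong (go t (inject₁ i) (≡.trans (Finₚ.toℕ-inject₁ i) (ℕₚ.suc-injective i≡t)))))
               (T-orbit-suc (w Fin.zero) i))

  orbit-cong : ∀ {x y} → x ≈ y → orbit x ≈ᵛ orbit y
  orbit-cong x≈y i = *-congˡ (σ^.σ-cong (toℕ i) x≈y)

  orbit-0 : orbit 0# ≈ᵛ (λ _ → 0#)
  orbit-0 i = trans (*-congˡ (Automorphism.σ-0 (iter-isAutomorphism σ-aut (toℕ i)))) (zeroʳ _)

  orbit-lin : ∀ {k} c (b : Fin k → Carrier) → (∀ i → Fixed K σ (c i)) →
              orbit (Module.lin fieldModule c b) ≈ᵛ Module.lin (vectorModule (suc d)) c (orbit ∘ b)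
  orbit-lin {zero}  c b c-fixed = orbit-0
  orbit-lin {suc k} c b c-fixed x = begin
    orbit (c Fin.zero * b Fin.zero + rest) x
      ≈⟨ *-congˡ (σ^.σ-+ (toℕ x) _ _) ⟩
    bracketPow K σ α (toℕ x) * (iter K σ (toℕ x) (c Fin.zero * b Fin.zero) + iter K σ (toℕ x) rest)
      ≈⟨ distribˡ _ _ _ ⟩
    bracketPow K σ α (toℕ x) * iter K σ (toℕ x) (c Fin.zero * b Fin.zero) + orbit rest x
      ≈⟨ +-cong (*-congˡ (trans (σ^.σ-* (toℕ x) _ _) (*-congʳ (iter-fixed σ-aut (c-fixed Fin.zero) (toℕ x)))))
                (orbit-lin (c ∘ Fin.suc) (b ∘ Fin.suc) (c-fixed ∘ Fin.suc) x) ⟩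
    bracketPow K σ α (toℕ x) * (c Fin.zero * iter K σ (toℕ x) (b Fin.zero)) + _
      ≈⟨ +-congʳ (x*yz≈y*xz _ _ _) ⟩
    c Fin.zero * orbit (b Fin.zero) x + Module.lin (vectorModule (suc d)) (c ∘ Fin.suc) (orbit ∘ b ∘ Fin.suc) x ∎
    where rest = Module.lin fieldModule (c ∘ Fin.suc) (b ∘ Fin.suc)

  module WithPeriod (n : ℕ) (σ-period : ∀ x → iter K σ n x ≈ x) where
    open SemilinearOperator σ-aut 𝕋 using (module PeriodicVectors)
    open PeriodicVectors n σ-period using (Periodic)

    A-λI : Matrix K (suc d)
    A-λI = shiftMat K (A-L K σ n (suc d) a) (Norm K σ n α)

    LeftKernel : Vector (suc d) → Set
    LeftKernel w = w ·ᴹ A-λI ≈ᵛ (λ _ → 0#)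

    T-iterate·ᴹA : ∀ w → iterate T n w ·ᴹ A-L K σ n (suc d) a ≈ᵛ (λ i → Norm K σ n α * w i)
    T-iterate·ᴹA w i = trans (T-iterate·ᴹP n w i) (*-congˡ (σ-period (w i)))

    Periodic⇒LeftKernel : ∀ w → Periodic w → LeftKernel w
    Periodic⇒LeftKernel w per j = trans (·ᴹ-shiftMat (A-L K σ n (suc d) a) (Norm K σ n α) w j)
      (x≈y⇒x∙y⁻¹≈ε (trans (sym (·ᴹ-congˡ (A-L K σ n (suc d) a) per j)) (T-iterate·ᴹA w j)))

    LeftKernel⇒Periodic : ∀ w → LeftKernel w → Periodic w
    LeftKernel⇒Periodic w w∈ i = x∙y⁻¹≈ε⇒x≈y _ _ (·ᴹ-P-injective n (λ i → iterate T n w i - w i) (λ k → begin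
      ((λ i → iterate T n w i - w i) ·ᴹ P n) k             ≈⟨ -‿·ᴹ (iterate T n w) w (P n) k ⟩
      (iterate T n w ·ᴹ P n) k - (w ·ᴹ P n) k              ≈⟨ +-congʳ (T-iterate·ᴹA w k) ⟩
      Norm K σ n α * w k - (w ·ᴹ P n) k                    ≈⟨ x≈y⇒x∙y⁻¹≈ε (sym (x∙y⁻¹≈ε⇒x≈y _ _ (w·A≈λw k))) ⟩
      0#                                                    ∎) i)
      where
        w·A≈λw : ∀ k → (w ·ᴹ P n) k - Norm K σ n α * w k ≈ 0#
        w·A≈λw k = trans (sym (·ᴹ-shiftMat (P n) (Norm K σ n α) w k)) (w∈ k)

module Transpose (K : FiniteField) where
  open FieldProperties K
  open Modules K
  open Counting K
  open Matrices K
  open Bases K using (2≤count; allOfK-isSubfield)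
  private module Sᴷ = VectorSums allOfK

  infixr 7 _ᴹ·_
  _ᴹ·_ : ∀ {D} → Matrix K D → Vector D → Vector D
  (M ᴹ· v) i = ∑ K (λ j → M i j * v j)

  dot : ∀ {D} → Vector D → Vector D → Carrier
  dot u v = ∑ K (λ i → u i * v i)

  ᴹ·-+ : ∀ {D} (M : Matrix K D) u v → M ᴹ· (λ j → u j + v j) ≈ᵛ (λ i → (M ᴹ· u) i + (M ᴹ· v) i)
  ᴹ·-+ M u v i = trans (∑-cong (λ j → distribˡ (M i j) (u j) (v j))) (∑-distrib-+ (λ j → M i j * u j) (λ j → M i j * v j))

  ᴹ·-* : ∀ {D} (M : Matrix K D) a u → M ᴹ· (λ j → a * u j) ≈ᵛ (λ i → a * (M ᴹ· u) i)
  ᴹ·-* M a u i = trans (∑-cong (λ j → x*yz≈y*xz (M i j) a (u j))) (∑-*ˡ a (λ j → M i j * u j))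

  #orthogonal : ∀ D → Vector D → ℕ
  #orthogonal D u = ∑ᴷ D (λ w → 𝟙 (dot w u ≟ 0#))

  #orthogonal-𝟘 : ∀ D (u : Vector D) → u ≈ᵛ (λ _ → 0#) → #orthogonal D u ≡ size ^ D
  #orthogonal-𝟘 D u u≈0 = ≡.trans
    (∑ᴷ-cong D (λ w _ → 𝟙-yes (dot w u ≟ 0#) (∑-0 (λ i → w i * u i) (λ i → trans (*-congˡ (u≈0 i)) (zeroʳ _)))))
    (≡.trans (∑ᴷ-const D 1) (ℕₚ.*-identityʳ _))

  -- For u₀ ≉ 0 each choice of the tail of w leaves exactly one solution for w₀.
  size*#orthogonal-≉𝟘 : ∀ D (u : Vector D) → ¬ u ≈ᵛ (λ _ → 0#) → size ℕ.* #orthogonal D u ≡ size ^ D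
  size*#orthogonal-≉𝟘 zero    u u≉0 = ⊥-elim (u≉0 (λ ()))
  size*#orthogonal-≉𝟘 (suc D) u u≉0 with u Fin.zero ≟ 0#
  ... | no u₀≉0 = ≡.cong (size ℕ.*_) (≡.trans
      (≡.sym (Sᴷ.∑ᵛ-∑-comm D size (λ w′ i → 𝟙 (dot (enum i ∷ w′) u ≟ 0#))))
      (≡.trans (∑ᴷ-cong D (λ w′ _ → ≡.trans
                 (sum-cong-≗ {size} (λ i → 𝟙-⇔ (dot (enum i ∷ w′) u ≟ 0#) (enum i ≟ solution w′) (unique w′ (enum i)) (solves w′ (enum i))))
                 (Sᴷ.∑-𝟙-≈ (solution w′) tt)))
               (≡.trans (∑ᴷ-const D 1) (ℕₚ.*-identityʳ _))))
    where
      solution : Vector D → Carrier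
      solution w′ = - (inv (u Fin.zero) * dot w′ (tail u))

      unique : ∀ w′ x → x * u Fin.zero + dot w′ (tail u) ≈ 0# → x ≈ solution w′
      unique w′ x e = c*x+y≈0⇒x≈-[c⁻¹*y] u₀≉0 (trans (+-congʳ (*-comm _ _)) e)

      solves : ∀ w′ x → x ≈ solution w′ → x * u Fin.zero + dot w′ (tail u) ≈ 0#
      solves w′ x x≈ = begin
        x * u Fin.zero + dot w′ (tail u)                                ≈⟨ +-congʳ (*-comm _ _) ⟩
        u Fin.zero * x + dot w′ (tail u)                                ≈⟨ +-congʳ (*-congˡ x≈) ⟩
        u Fin.zero * - (inv (u Fin.zero) * dot w′ (tail u)) + dot w′ (tail u)
          ≈⟨ +-congʳ (-‿distribʳ-* _ _) ⟨
        - (u Fin.zero * (inv (u Fin.zero) * dot w′ (tail u))) + dot w′ (tail u)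
          ≈⟨ +-congʳ (-‿cong (trans (sym (*-assoc _ _ _)) (trans (*-congʳ (inv-r _ u₀≉0)) (*-identityˡ _)))) ⟩
        - dot w′ (tail u) + dot w′ (tail u)                             ≈⟨ -‿inverseˡ _ ⟩
        0#                                                              ∎
        where open SetoidReasoning setoid
  ... | yes u₀≈0 = ≡.cong (size ℕ.*_) (≡.trans
      (sum-cong-≗ {size} (λ i → ∑ᴷ-cong D (λ w′ _ → 𝟙-⇔ (dot (enum i ∷ w′) u ≟ 0#) (dot w′ (tail u) ≟ 0#)
        (λ e → trans (sym (head-vanishes i w′)) e) (λ e → trans (head-vanishes i w′) e))))
      (≡.trans (∑ℕ-const size (#orthogonal D (tail u))) (size*#orthogonal-≉𝟘 D (tail u) (λ t≈0 → u≉0 λ { Fin.zero → u₀≈0 ; (Fin.suc i) → t≈0 i }))))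
    where
      head-vanishes : ∀ i (w′ : Vector D) → enum i * u Fin.zero + dot w′ (tail u) ≈ dot w′ (tail u)
      head-vanishes i w′ = trans (+-congʳ (trans (*-congˡ u₀≈0) (zeroʳ _))) (+-identityˡ _)

  dot-ᴹ· : ∀ {D} (M : Matrix K D) w v → dot w (M ᴹ· v) ≈ dot v (w ·ᴹ M)
  dot-ᴹ· M w v = begin
    ∑ K (λ i → w i * ∑ K (λ j → M i j * v j))      ≈⟨ ∑-cong (λ i → ∑-*ˡ (w i) (λ j → M i j * v j)) ⟨
    ∑ K (λ i → ∑ K (λ j → w i * (M i j * v j)))    ≈⟨ ∑-comm (λ i j → w i * (M i j * v j)) ⟩
    ∑ K (λ j → ∑ K (λ i → w i * (M i j * v j)))    ≈⟨ ∑-cong (λ j → ∑-cong (λ i → x*yz≈yx*z (w i) (M i j) (v j))) ⟩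
    ∑ K (λ j → ∑ K (λ i → (M i j * w i) * v j))    ≈⟨ ∑-cong (λ j → ∑-cong (λ i → *-congʳ (*-comm (M i j) (w i)))) ⟩
    ∑ K (λ j → ∑ K (λ i → (w i * M i j) * v j))    ≈⟨ ∑-cong (λ j → ∑-*ʳ (v j) (λ i → w i * M i j)) ⟩
    ∑ K (λ j → (w ·ᴹ M) j * v j)                   ≈⟨ ∑-cong (λ j → *-comm ((w ·ᴹ M) j) (v j)) ⟩
    ∑ K (λ j → v j * (w ·ᴹ M) j)                   ∎
    where open SetoidReasoning setoid

  module _ {D : ℕ} (M : Matrix K D) where
    Kernel? : ∀ v → Dec (M ᴹ· v ≈ᵛ (λ _ → 0#))
    Kernel? v = M ᴹ· v ≟ᵛ (λ _ → 0#)

    LeftKernel? : ∀ w → Dec (w ·ᴹ M ≈ᵛ (λ _ → 0#))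
    LeftKernel? w = w ·ᴹ M ≟ᵛ (λ _ → 0#)

    private
      size*#orthogonal : ∀ s → size ≡ suc s → ∀ (u : Vector D) →
        size ℕ.* #orthogonal D u ≡ size ^ D ℕ.+ 𝟙 (u ≟ᵛ (λ _ → 0#)) ℕ.* (s ℕ.* size ^ D)
      size*#orthogonal s size≡ u with u ≟ᵛ (λ _ → 0#)
      ... | yes u≈0 = ≡.trans (≡.cong₂ ℕ._*_ size≡ (#orthogonal-𝟘 D u u≈0)) (≡.cong (size ^ D ℕ.+_) (≡.sym (ℕₚ.+-identityʳ _)))
      ... | no u≉0  = ≡.trans (size*#orthogonal-≉𝟘 D u u≉0) (≡.sym (ℕₚ.+-identityʳ _))

      size*∑#orthogonal : ∀ s → size ≡ suc s → (f : Vector D → Vector D) →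
        size ℕ.* ∑ᴷ D (λ v → #orthogonal D (f v))
          ≡ size ^ D ℕ.* size ^ D ℕ.+ (s ℕ.* size ^ D) ℕ.* ∑ᴷ D (λ v → 𝟙 (f v ≟ᵛ (λ _ → 0#)))
      size*∑#orthogonal s size≡ f = begin
        size ℕ.* ∑ᴷ D (λ v → #orthogonal D (f v))
          ≡⟨ Sᴷ.∑ᵛ-*ˡ D size (λ v → #orthogonal D (f v)) ⟨
        ∑ᴷ D (λ v → size ℕ.* #orthogonal D (f v))
          ≡⟨ ∑ᴷ-cong D (λ v _ → size*#orthogonal s size≡ (f v)) ⟩
        ∑ᴷ D (λ v → size ^ D ℕ.+ 𝟙 (f v ≟ᵛ (λ _ → 0#)) ℕ.* (s ℕ.* size ^ D))
          ≡⟨ Sᴷ.∑ᵛ-distrib-+ D (λ _ → size ^ D) (λ v → 𝟙 (f v ≟ᵛ (λ _ → 0#)) ℕ.* (s ℕ.* size ^ D)) ⟩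
        ∑ᴷ D (λ _ → size ^ D) ℕ.+ ∑ᴷ D (λ v → 𝟙 (f v ≟ᵛ (λ _ → 0#)) ℕ.* (s ℕ.* size ^ D))
          ≡⟨ ≡.cong₂ ℕ._+_ (∑ᴷ-const D (size ^ D))
               (≡.trans (∑ᴷ-cong D (λ v _ → ℕₚ.*-comm (𝟙 (f v ≟ᵛ (λ _ → 0#))) (s ℕ.* size ^ D)))
                        (Sᴷ.∑ᵛ-*ˡ D (s ℕ.* size ^ D) (λ v → 𝟙 (f v ≟ᵛ (λ _ → 0#))))) ⟩
        size ^ D ℕ.* size ^ D ℕ.+ (s ℕ.* size ^ D) ℕ.* ∑ᴷ D (λ v → 𝟙 (f v ≟ᵛ (λ _ → 0#))) ∎
        where open ≡.≡-Reasoning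

      ∑#orthogonal-ᴹ· : ∑ᴷ D (λ v → #orthogonal D (M ᴹ· v)) ≡ ∑ᴷ D (λ w → #orthogonal D (w ·ᴹ M))
      ∑#orthogonal-ᴹ· = ≡.trans (≡.sym (∑ᵛ-comm allOfK allOfK D D (λ w v → 𝟙 (dot w (M ᴹ· v) ≟ 0#))))
        (∑ᴷ-cong D (λ w _ → ∑ᴷ-cong D (λ v _ → 𝟙-⇔ (dot w (M ᴹ· v) ≟ 0#) (dot v (w ·ᴹ M) ≟ 0#)
          (trans (sym (dot-ᴹ· M w v))) (trans (dot-ᴹ· M w v)))))

    #kernel≡#leftKernel : ∑ᴷ D (λ v → 𝟙 (Kernel? v)) ≡ ∑ᴷ D (λ w → 𝟙 (LeftKernel? w))
    #kernel≡#leftKernel = ℕₚ.*-cancelˡ-≡ _ _ (s ℕ.* size ^ D) {{nonZero}}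
      (ℕₚ.+-cancelˡ-≡ (size ^ D ℕ.* size ^ D) _ _
        (≡.trans (≡.sym (size*∑#orthogonal s size≡1+s (M ᴹ·_)))
        (≡.trans (≡.cong (size ℕ.*_) ∑#orthogonal-ᴹ·) (size*∑#orthogonal s size≡1+s (_·ᴹ M)))))
      where
        2≤size = 2≤count allOfK allOfK-isSubfield
        s = size ∸ 1
        size≡1+s : size ≡ suc s
        size≡1+s = ≡.sym (ℕₚ.m+[n∸m]≡n (ℕₚ.≤-trans (s≤s z≤n) 2≤size))
        nonZero : ℕ.NonZero (s ℕ.* size ^ D)
        nonZero = ℕ.>-nonZero (ℕₚ.*-mono-≤ (ℕₚ.∸-monoˡ-≤ 1 2≤size) (ℕₚ.m^n>0 size {{ℕ.>-nonZero (ℕₚ.≤-trans (s≤s z≤n) 2≤size)}} D))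

module Main (K : FiniteField) {σ : FiniteField.Carrier K → FiniteField.Carrier K} (σ-aut : IsAutomorphism K σ)
  {q : ℕ} (fixed-card : HasCard K (Fixed K σ) q)
  (n n′ : ℕ) (n≡1+n′ : n ≡ suc n′) (σ-period : ∀ x → FiniteField._≈_ K (iter K σ n x) x)
  (σ-distinct : Dedekind.Distinct K (λ (j : Fin (suc n′)) → iter K σ (toℕ j)))
  (d : ℕ) (a : Fin (suc (suc d)) → FiniteField.Carrier K)
  (a-top≉0 : ¬ FiniteField._≈_ K (a (fromℕ (suc d))) (FiniteField.0# K))
  (a₀≉0 : ¬ FiniteField._≈_ K (a Fin.zero) (FiniteField.0# K))
  (α : FiniteField.Carrier K) where
  open FieldProperties K
  open Automorphisms K
  open Modules K
  open Counting K
  open Bases K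
  open Descent K
  open Transpose K
  open FixedField K σ-aut fixed-card
  open LinearisedPolynomial K σ-aut d a a-top≉0 a₀≉0 α
  open WithPeriod n σ-period
  open SemilinearOperator σ-aut 𝕋 using (T-lin; module PeriodicVectors; module GaloisDescent)
  open PeriodicVectors n σ-period

  period-1+n′ : ∀ {v} → Periodic v → iterate T (suc n′) v ≈ᵛ v
  period-1+n′ {v} = ≡.subst (λ m → iterate T m v ≈ᵛ v) n≡1+n′

  open GaloisDescent n′ σ-distinct Periodic Periodic-resp Periodic-𝟘 Periodic-+ Periodic-* Periodic-T period-1+n′
    using (Invariant; descent)

  KernelLα : Carrier → Set
  KernelLα x = evalLα K σ (suc d) a α x ≈ 0#

  Kernel : Vector (suc d) → Set
  Kernel v = A-λI ᴹ· v ≈ᵛ (λ _ → 0#)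

  Periodic? : ∀ v → Dec (Periodic v)
  Periodic? v = iterate T n v ≟ᵛ v

  Invariant? : ∀ v → Dec (Invariant v)
  Invariant? v with Periodic? v | T v ≟ᵛ v
  ... | yes per | yes fixed = yes (per , fixed)
  ... | no ¬per | _         = no (¬per ∘ proj₁)
  ... | _       | no ¬fixed = no (¬fixed ∘ proj₂)

  Invariant-resp : ∀ {u v} → u ≈ᵛ v → Invariant u → Invariant v
  Invariant-resp u≈v (per , fixed) = Periodic-resp u≈v per , λ i → trans (sym (T-cong u≈v i)) (trans (fixed i) (u≈v i))

  Kernel-lin : ∀ {j} (b : Fin j → Vector (suc d)) → (∀ i → Kernel (b i)) →
               ∀ c → (∀ i → ⊤) → Kernel (Module.lin (vectorModule (suc d)) c b)
  Kernel-lin b b∈ c c∈ = Module.lin-closed (vectorModule (suc d)) (λ _ → ⊤) Kernel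
    (λ i → Matrices.∑-0 K (λ j → A-λI i j * 0#) (λ j → zeroʳ _))
    (λ {u} {v} u∈ v∈ i → trans (ᴹ·-+ A-λI u v i) (trans (+-cong (u∈ i) (v∈ i)) (+-identityˡ 0#)))
    (λ {a′} {u} _ u∈ i → trans (ᴹ·-* A-λI a′ u i) (trans (*-congˡ (u∈ i)) (zeroʳ a′)))
    c b c∈ b∈

  Periodic-lin : ∀ {j} (b : Fin j → Vector (suc d)) → (∀ i → Periodic (b i)) →
                 ∀ c → (∀ i → ⊤) → Periodic (Module.lin (vectorModule (suc d)) c b)
  Periodic-lin b b∈ c c∈ =
    Module.lin-closed (vectorModule (suc d)) (λ _ → ⊤) Periodic Periodic-𝟘 Periodic-+ (λ {a′} _ → Periodic-* a′) c b c∈ b∈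

  #Periodic≡#Kernel : ∑ᴷ (suc d) (λ v → 𝟙 (Periodic? v)) ≡ ∑ᴷ (suc d) (λ v → 𝟙 (Kernel? A-λI v))
  #Periodic≡#Kernel = ≡.trans
    (∑ᴷ-cong (suc d) (λ w _ → 𝟙-⇔ (Periodic? w) (LeftKernel? A-λI w) (Periodic⇒LeftKernel w) (LeftKernel⇒Periodic w)))
    (≡.sym (#kernel≡#leftKernel A-λI))

  T-fixed⇒KernelLα-head : ∀ v → T v ≈ᵛ v → KernelLα (v Fin.zero)
  T-fixed⇒KernelLα-head v fixed = T-fixed⇒evalLα≈0 (v Fin.zero)
    (trans (sym (T-cong v≈orbit Fin.zero)) (trans (fixed Fin.zero) (v≈orbit Fin.zero)))
    where v≈orbit = T-fixed⇒orbit v fixed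

  evalLα≈0⇒Invariant : ∀ x → KernelLα x → Invariant (orbit x)
  evalLα≈0⇒Invariant x Lx≈0 = T-fixed⇒Periodic (evalLα≈0⇒T-fixed x Lx≈0) , evalLα≈0⇒T-fixed x Lx≈0

  kernelBasis⇒invariantBasis : ∀ {k} → Basis fieldModule (Fixed K σ) KernelLα k → Basis (vectorModule (suc d)) (Fixed K σ) Invariant k
  kernelBasis⇒invariantBasis B = record
    { vec = orbit ∘ vec
    ; vec∈W = λ i → evalLα≈0⇒Invariant (vec i) (vec∈W i)
    ; independent = λ c c∈ lin≈0 → independent c c∈ (trans (sym (*-identityˡ _)) (trans (orbit-lin c vec c∈ Fin.zero) (lin≈0 Fin.zero)))
    ; spanning = λ v (_ , fixed) →
        let (c , c∈ , v₀≈) = spanning (v Fin.zero) (T-fixed⇒KernelLα-head v fixed) in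
        c , c∈ , λ i → trans (T-fixed⇒orbit v fixed i) (trans (orbit-cong v₀≈ i) (orbit-lin c vec c∈ i))
    }
    where open Basis B

  invariantBasis⇒kernelBasis : ∀ {k} → Basis (vectorModule (suc d)) (Fixed K σ) Invariant k → Basis fieldModule (Fixed K σ) KernelLα k
  invariantBasis⇒kernelBasis B = record
    { vec = λ i → vec i Fin.zero
    ; vec∈W = λ i → T-fixed⇒KernelLα-head (vec i) (proj₂ (vec∈W i))
    ; independent = λ c c∈ lin≈0 → independent c c∈ (λ x → begin
        Module.lin (vectorModule (suc d)) c vec x
          ≈⟨ Module.lin-cong (vectorModule (suc d)) (λ _ → refl) (λ i → T-fixed⇒orbit (vec i) (proj₂ (vec∈W i))) x ⟩
        Module.lin (vectorModule (suc d)) c (λ i → orbit (vec i Fin.zero)) x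
          ≈⟨ orbit-lin c (λ i → vec i Fin.zero) c∈ x ⟨
        orbit (Module.lin fieldModule c (λ i → vec i Fin.zero)) x
          ≈⟨ orbit-cong lin≈0 x ⟩
        orbit 0# x
          ≈⟨ orbit-0 x ⟩
        0# ∎)
    ; spanning = λ x Lx≈0 →
        let (c , c∈ , orbit≈) = spanning (orbit x) (evalLα≈0⇒Invariant x Lx≈0) in
        c , c∈ , trans (sym (*-identityˡ x)) (trans (orbit≈ Fin.zero) (lin-apply c vec Fin.zero))
    }
    where
      open Basis B
      open SetoidReasoning setoid

  Kernel-resp : ∀ {u v} → u ≈ᵛ v → Kernel u → Kernel v
  Kernel-resp u≈v u∈ i = trans (Matrices.∑-cong K (λ j → *-congˡ {A-λI i j} (sym (u≈v j)))) (u∈ i)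

  #Periodic≡size^ : ∀ {k} → Basis (vectorModule (suc d)) (λ _ → ⊤) Periodic k → ∑ᴷ (suc d) (λ v → 𝟙 (Periodic? v)) ≡ size ^ k
  #Periodic≡size^ B = ∑ᴷ-𝟙-basis allOfK allOfK-isSubfield Periodic Periodic? Periodic-resp B (Periodic-lin vec vec∈W)
    where open Basis B

  nullityLα⇒nullityA : ∀ {k} → Basis fieldModule (Fixed K σ) KernelLα k → Basis (vectorModule (suc d)) (λ _ → ⊤) Kernel k
  nullityLα⇒nullityA B = basis-from-count allOfK allOfK-isSubfield Kernel (Kernel? A-λI) Kernel-resp Kernel-lin
    (≡.trans (≡.sym #Periodic≡#Kernel) (#Periodic≡size^ (descent (kernelBasis⇒invariantBasis B))))

  nullityA⇒nullityLα : ∀ {k} → Basis (vectorModule (suc d)) (λ _ → ⊤) Kernel k → Basis fieldModule (Fixed K σ) KernelLα k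
  nullityA⇒nullityLα {k} B = ≡.subst (Basis fieldModule (Fixed K σ) KernelLα) k′≡k (invariantBasis⇒kernelBasis (proj₂ fixedBasis))
    where
      fixedBasis = basis-exists fixedField fixedField-isSubfield Invariant Invariant? Invariant-resp
      k′≡k : proj₁ fixedBasis ≡ k
      k′≡k = ^-injectiveʳ size (2≤count allOfK allOfK-isSubfield)
        (≡.trans (≡.sym (#Periodic≡size^ (descent (proj₂ fixedBasis))))
        (≡.trans #Periodic≡#Kernel
                 (∑ᴷ-𝟙-basis allOfK allOfK-isSubfield Kernel (Kernel? A-λI) Kernel-resp B (Kernel-lin (Basis.vec B) (Basis.vec∈W B)))))

theorem5 : (K : FiniteField) (q n : ℕ) → 1 ≤ n → FiniteField.size K ≡ q ^ n
    → (σ : FiniteField.Carrier K → FiniteField.Carrier K)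
    → IsAutomorphism K σ → HasCard K (Fixed K σ) q
    → (d : ℕ) → 1 ≤ d → (a : Fin (suc d) → FiniteField.Carrier K)
    → ¬ FiniteField._≈_ K (a (fromℕ d)) (FiniteField.0# K)
    → ¬ FiniteField._≈_ K (a zero) (FiniteField.0# K)
    → (α : FiniteField.Carrier K) → ¬ FiniteField._≈_ K α (FiniteField.0# K)
    → (k : ℕ)
    → (NullityFq K σ (evalLα K σ d a α) k
        → NullityMat K (shiftMat K (A-L K σ n d a) (Norm K σ n α)) k)
    × (NullityMat K (shiftMat K (A-L K σ n d a) (Norm K σ n α)) k
        → NullityFq K σ (evalLα K σ d a α) k)
theorem5 K q n _ size≡q^n σ σ-aut fixed-card (suc d) (s≤s z≤n) a a-top≉0 a₀≉0 α _ k =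
    (λ nullity → basis⇒hasDim (vectorModule (suc d)) (λ _ → ⊤) Kernel
                   (nullityLα⇒nullityA (hasDim⇒basis fieldModule (Fixed K σ) KernelLα nullity)))
  , (λ nullity → basis⇒hasDim fieldModule (Fixed K σ) KernelLα
                   (nullityA⇒nullityLα (hasDim⇒basis (vectorModule (suc d)) (λ _ → ⊤) Kernel nullity)))
  where
    open Modules K
    open Artin.Order (Artin.σ-order K σ-aut {q} {n} size≡q^n fixed-card)
    open Main K σ-aut fixed-card n n′ n≡1+n′ period distinct d a a-top≉0 a₀≉0 α
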